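{- Let $p(z)\in\mathbb{Z}[z]$ be a non-odd polynomial of degree $d\geq2$ with positive leading coefficient. Suppose $0<\frac1k\ll\frac1\ell\ll\frac1q\ll\frac{1}{\|p\|},\frac1d\le\frac12$ with $k,\ell,q$ positive integers. Then for every positive integer $Q'\le qk^{d-1}$ there exists an integer vector $\mathbf{v}'=(v'_1,\dots,v'_{k_0-k})\in[-\ell,\ell]^{k_0-k}$ such that $$\sum_{i=1}^{k_0-k}v'_i\,m_i(k)=Q'\pm\ell$$ and $v'_i=0$ for all $i\notin\{t2^j: t\in[d-1],\ 1\le j\le q+\tfrac12\log_2 k\}$.
   Context: Write $p(z)=a_dz^d+\dots+a_0$ and $\|p\|=d+\sum_i|a_i|$. A polynomial is odd if it takes only odd values on $\mathbb{Z}$, non-odd otherwise. $m_s(k)=p(k+s)-p(k)$ and $k_0=\max\{t: p(t)<2p(k)-4m_1(k)\}$. $[a,b]$ denotes the set of integers between $a$ and $b$. $x=y\pm c$ means $y-c\le x\le y+c$. The hierarchy notation $0<a\ll b\ll\dots$ means each constant is chosen sufficiently small (or for $1/k$: $k$ sufficiently large) in terms of the constants to its right; the claim asserts that suitable thresholds exist. -}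

module Defs where

open import Data.Nat as ℕ using (ℕ; suc)
open import Data.Integer as ℤ using (ℤ; +_; _+_; _-_; _*_; _^_; ∣_∣; _<_)
open import Data.Integer.Divisibility as ℤD using ()
open import Data.Fin using (Fin; toℕ; fromℕ)
open import Data.List using (List; foldr; map; allFin)
open import Data.Product using (_×_)
open import Relation.Nullary using (¬_)

Σℤ : (n : ℕ) → (Fin n → ℤ) → ℤ
Σℤ n f = foldr _+_ (+ 0) (map f (allFin n))

-- A polynomial p(z) = a_d z^d + ... + a_0 ∈ ℤ[z], given by its formal degree d
-- and its coefficients a_0, ..., a_d (index i ↦ a_i).  The degree is exactly d
-- once the leading coefficient a_d is required to be nonzero (positive).
record Poly : Set where
  field
    deg  : ℕ
    coef : Fin (suc deg) → ℤ

open Poly public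

leading : Poly → ℤ
leading p = coef p (fromℕ (deg p))

eval : Poly → ℤ → ℤ
eval p z = Σℤ (suc (deg p)) (λ i → coef p i * z ^ toℕ i)

norm : Poly → ℕ
norm p = deg p ℕ.+ foldr ℕ._+_ 0 (map (λ i → ∣ coef p i ∣) (allFin (suc (deg p))))

OddInt : ℤ → Set
OddInt n = ¬ ((+ 2) ℤD.∣ n)

OddPoly : Poly → Set
OddPoly p = (z : ℤ) → OddInt (eval p z)

NonOdd : Poly → Set
NonOdd p = ¬ OddPoly p

m : Poly → ℤ → ℤ → ℤ
m p s k = eval p (k + s) - eval p k

K0Cond : Poly → ℤ → ℤ → Set
K0Cond p k t = eval p t < (+ 2) * eval p k - (+ 4) * m p (+ 1) k

IsK0 : Poly → ℤ → ℤ → Set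
IsK0 p k t = K0Cond p k t × ((t' : ℤ) → t < t' → ¬ K0Cond p k t')

-- Taylor expansion at k gives m_x(k) = Σ_{s=1..d} c_s(k) xˢ, where c_s(k) ≈ (d choose s)·a_d·k^{d−s}
-- is positive for large k. Pairing m_{2^{j+e}}(k), e = 0, 1, …, with the coefficients of
-- Π_{r≠s} ±(X − 2ʳ) kills every power except xˢ and leaves c_s(k)·2^{js} times a positive constant.
-- For 1 ≤ s ≤ d and 1 ≤ j ≤ J, where 4^J ≈ k, these values climb from O(1) past q·k^{d−1} with
-- bounded ratios between neighbours, so a greedy expansion writes Q′ through them with bounded
-- digits and a bounded remainder. The indices used are powers of two below 2^q·√k, whereas
-- k₀ − k is of order k.

module Submission where

open import Data.Nat as ℕ using (ℕ; zero; suc; z≤n; s≤s)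
import Data.Nat.Properties as ℕP
open import Data.Nat.Combinatorics using (_C_; k>n⇒nCk≡0; nCk+nC[k+1]≡[n+1]C[k+1])
open import Data.Integer as ℤ using (ℤ; +_; -[1+_]; ∣_∣; _+_; _*_; -_; _-_; 0ℤ; 1ℤ; _^_)
import Data.Integer.Properties as ℤP
open import Data.Integer.Tactic.RingSolver using (solve-∀)
import Data.Nat.Tactic.RingSolver as ℕSolver
open import Data.Fin as Fin using (Fin; toℕ)
import Data.Fin.Properties as FinP
open import Data.List using (List; []; _∷_; length)
import Data.List.Properties as ListP
open import Data.Product using (_×_; _,_; ∃-syntax; Σ-syntax; proj₁; proj₂)
open import Data.Empty using (⊥-elim)
open import Relation.Nullary using (yes; no)
open import Relation.Binary.PropositionalEquality hiding (J)
open import Relation.Binary.Definitions using (tri<; tri≈; tri>)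
open import Function using (_∘_)
open import Defs

pos-^ : ∀ a n → + (a ℕ.^ n) ≡ (+ a) ^ n
pos-^ a zero    = refl
pos-^ a (suc n) = trans (ℤP.pos-* a (a ℕ.^ n)) (cong (+ a *_) (pos-^ a n))

1≤2^ : ∀ n → 1 ℕ.≤ 2 ℕ.^ n
1≤2^ = ℕP.m^n>0 2

1≤^ : ∀ {k} → 1 ℕ.≤ k → ∀ n → 1 ℕ.≤ k ℕ.^ n
1≤^ {suc k} _ = ℕP.m^n>0 (suc k)

^-monoʳ-≤ : ∀ {k} → 1 ℕ.≤ k → ∀ {m n} → m ℕ.≤ n → k ℕ.^ m ℕ.≤ k ℕ.^ n
^-monoʳ-≤ {suc k} _ = ℕP.^-monoʳ-≤ (suc k)

2^-monoʳ-< : ∀ {m n} → m ℕ.< n → 2 ℕ.^ m ℕ.< 2 ℕ.^ n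
2^-monoʳ-< = ℕP.^-monoʳ-< 2 (s≤s (s≤s z≤n))

2^-injective : ∀ {m n} → 2 ℕ.^ m ≡ 2 ℕ.^ n → m ≡ n
2^-injective {m} {n} eq with ℕP.<-cmp m n
... | tri< m<n _ _ = ⊥-elim (ℕP.<-irrefl eq (2^-monoʳ-< m<n))
... | tri≈ _ m≡n _ = m≡n
... | tri> _ _ n<m = ⊥-elim (ℕP.<-irrefl (sym eq) (2^-monoʳ-< n<m))

nC0≡1 : ∀ n → n C 0 ≡ 1
nC0≡1 zero    = refl
nC0≡1 (suc n) = refl

nCk≤2^n : ∀ n k → n C k ℕ.≤ 2 ℕ.^ n
nCk≤2^n zero    zero    = ℕP.≤-refl
nCk≤2^n zero    (suc k) = z≤n
nCk≤2^n (suc n) zero    = ℕP.≤-trans (ℕP.≤-reflexive (nC0≡1 (suc n))) (1≤2^ (suc n))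
nCk≤2^n (suc n) (suc k) = begin
  suc n C suc k       ≡⟨ nCk+nC[k+1]≡[n+1]C[k+1] n k ⟨
  n C k ℕ.+ n C suc k ≤⟨ ℕP.+-mono-≤ (nCk≤2^n n k) (nCk≤2^n n (suc k)) ⟩
  2 ℕ.^ n ℕ.+ 2 ℕ.^ n ≡⟨ cong (2 ℕ.^ n ℕ.+_) (ℕP.+-identityʳ (2 ℕ.^ n)) ⟨
  2 ℕ.^ suc n         ∎
  where open ℕP.≤-Reasoning

1≤nCk : ∀ n k → k ℕ.≤ n → 1 ℕ.≤ n C k
1≤nCk n       zero    _         = ℕP.≤-reflexive (sym (nC0≡1 n))
1≤nCk (suc n) (suc k) (s≤s k≤n) = ℕP.≤-trans (1≤nCk n k k≤n)
  (ℕP.≤-trans (ℕP.m≤m+n (n C k) (n C suc k)) (ℕP.≤-reflexive (nCk+nC[k+1]≡[n+1]C[k+1] n k)))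

square-cancel-≤ : ∀ a b → a ℕ.* a ℕ.≤ b ℕ.* b → a ℕ.≤ b
square-cancel-≤ a b a²≤b² with a ℕ.≤? b
... | yes a≤b = a≤b
... | no  a≰b = ⊥-elim (ℕP.<⇒≱ (ℕP.*-mono-< b<a b<a) a²≤b²)
  where
  b<a : b ℕ.< a
  b<a = ℕP.≰⇒> a≰b

4^ : ℕ → ℕ
4^ j = 2 ℕ.^ (2 ℕ.* j)

4^-suc : ∀ j → 4^ (suc j) ≡ 4 ℕ.* 4^ j
4^-suc j = trans (cong (2 ℕ.^_) (ℕP.*-suc 2 j)) (ℕP.^-distribˡ-+-* 2 2 (2 ℕ.* j))

4^-+ : ∀ i j → 4^ (i ℕ.+ j) ≡ 4^ i ℕ.* 4^ j
4^-+ i j = trans (cong (2 ℕ.^_) (ℕP.*-distribˡ-+ 2 i j)) (ℕP.^-distribˡ-+-* 2 (2 ℕ.* i) (2 ℕ.* j))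

4^≡2^*2^ : ∀ j → 4^ j ≡ 2 ℕ.^ j ℕ.* 2 ℕ.^ j
4^≡2^*2^ j = trans (cong (λ e → 2 ℕ.^ (j ℕ.+ e)) (ℕP.+-identityʳ j)) (ℕP.^-distribˡ-+-* 2 j j)

4^-mono-≤ : ∀ {i j} → i ℕ.≤ j → 4^ i ℕ.≤ 4^ j
4^-mono-≤ i≤j = ℕP.^-monoʳ-≤ 2 (ℕP.*-monoʳ-≤ 2 i≤j)

4^-between : ∀ k → 1 ℕ.≤ k → ∃[ j ] (k ℕ.≤ 4^ j × 4^ j ℕ.≤ 4 ℕ.* k)
4^-between (suc zero)    _ = 0 , ℕP.≤-refl , s≤s z≤n
4^-between (suc (suc k)) _ with 4^-between (suc k) (s≤s z≤n)
... | j , k<4^j , 4^j≤4k with suc (suc k) ℕ.≤? 4^ j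
...   | yes k+2≤4^j = j , k+2≤4^j , ℕP.≤-trans 4^j≤4k (ℕP.*-monoʳ-≤ 4 (ℕP.n≤1+n (suc k)))
...   | no  k+2≰4^j = suc j , ℕP.≤-trans k+2≤4[k+1] (ℕP.≤-reflexive (sym 4^j+1≡4k)) ,
                      ℕP.≤-trans (ℕP.≤-reflexive 4^j+1≡4k) (ℕP.*-monoʳ-≤ 4 (ℕP.n≤1+n (suc k)))
  where
  k+2≤4[k+1] : suc (suc k) ℕ.≤ 4 ℕ.* suc k
  k+2≤4[k+1] = ℕP.≤-trans (ℕP.+-mono-≤ {2} {4} (s≤s (s≤s z≤n)) (ℕP.m≤n*m k 4)) (ℕP.≤-reflexive (sym (ℕP.*-suc 4 k)))
  4^j≡k+1 : 4^ j ≡ suc k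
  4^j≡k+1 = ℕP.≤-antisym (ℕP.≤-pred (ℕP.≰⇒> k+2≰4^j)) k<4^j
  4^j+1≡4k : 4^ (suc j) ≡ 4 ℕ.* suc k
  4^j+1≡4k = trans (4^-suc j) (cong (4 ℕ.*_) 4^j≡k+1)

∣i∣≤b⇒-b≤i : ∀ x {b} → ∣ x ∣ ℕ.≤ b → - (+ b) ℤ.≤ x
∣i∣≤b⇒-b≤i (+ n)    _           = ℤP.neg-≤-pos
∣i∣≤b⇒-b≤i -[1+ n ] {suc b} (s≤s n≤b) = ℤ.-≤- n≤b

2b≤a⇒a≤2[a∸b] : ∀ a b → 2 ℕ.* b ℕ.≤ a → a ℕ.≤ 2 ℕ.* (a ℕ.∸ b)
2b≤a⇒a≤2[a∸b] a b 2b≤a = begin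
  a                         ≡⟨ ℕP.m∸n+n≡m b≤a ⟨
  (a ℕ.∸ b) ℕ.+ b           ≤⟨ ℕP.+-monoʳ-≤ (a ℕ.∸ b) (ℕP.m+n≤o⇒m≤o∸n b (ℕP.≤-trans (ℕP.≤-reflexive (cong (b ℕ.+_) (sym (ℕP.+-identityʳ b)))) 2b≤a)) ⟩
  (a ℕ.∸ b) ℕ.+ (a ℕ.∸ b)   ≡⟨ cong ((a ℕ.∸ b) ℕ.+_) (ℕP.+-identityʳ (a ℕ.∸ b)) ⟨
  2 ℕ.* (a ℕ.∸ b)           ∎
  where
  open ℕP.≤-Reasoning
  b≤a : b ℕ.≤ a
  b≤a = ℕP.≤-trans (ℕP.m≤m+n b (b ℕ.+ 0)) 2b≤a

dominated-sum : ∀ x y a b → + a ℤ.≤ y → ∣ x ∣ ℕ.≤ b → 2 ℕ.* b ℕ.≤ a → x + y ≡ + ∣ x + y ∣ × a ℕ.≤ 2 ℕ.* ∣ x + y ∣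
dominated-sum x y a b a≤y ∣x∣≤b 2b≤a = nonneg (ℤP.≤-trans (ℤP.≤-reflexive a∸b≡) (ℤP.+-mono-≤ (∣i∣≤b⇒-b≤i x ∣x∣≤b) a≤y))
  where
  a∸b≡ : + (a ℕ.∸ b) ≡ - (+ b) + + a
  a∸b≡ = sym (trans (ℤP.-m+n≡n⊖m b a) (ℤP.⊖-≥ (ℕP.≤-trans (ℕP.m≤m+n b (b ℕ.+ 0)) 2b≤a)))
  nonneg : ∀ {z} → + (a ℕ.∸ b) ℤ.≤ z → z ≡ + ∣ z ∣ × a ℕ.≤ 2 ℕ.* ∣ z ∣
  nonneg {+ n} (ℤ.+≤+ a∸b≤n) = refl , ℕP.≤-trans (2b≤a⇒a≤2[a∸b] a b 2b≤a) (ℕP.*-monoʳ-≤ 2 a∸b≤n)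

+n≤a*+n : ∀ a n → + 0 ℤ.< a → + n ℤ.≤ a * + n
+n≤a*+n (+ zero)  n (ℤ.+<+ ())
+n≤a*+n (+ suc m) n _ = ℤP.≤-trans (ℤ.+≤+ (ℕP.m≤n*m n (suc m))) (ℤP.≤-reflexive (ℤP.pos-* (suc m) n))

i≤+∣i∣ : ∀ i → i ℤ.≤ + ∣ i ∣
i≤+∣i∣ (+ n)    = ℤP.≤-refl
i≤+∣i∣ -[1+ n ] = ℤ.-≤+

[d∸[1+r]]+r≡d∸1 : ∀ {d r} → r ℕ.< d → (d ℕ.∸ suc r) ℕ.+ r ≡ d ℕ.∸ 1
[d∸[1+r]]+r≡d∸1 {suc d} (s≤s r≤d) = ℕP.m∸n+n≡m r≤d

+≤⇒≤×≤ : ∀ {a b k} → a ℕ.+ b ℕ.≤ k → a ℕ.≤ k × b ℕ.≤ k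
+≤⇒≤×≤ {a} {b} a+b≤k = ℕP.≤-trans (ℕP.m≤m+n a b) a+b≤k , ℕP.≤-trans (ℕP.m≤n+m b a) a+b≤k

4^suc-between : ∀ k → 2 ℕ.≤ k → ∃[ J ] (k ℕ.≤ 4^ (suc J) × 4^ (suc J) ℕ.≤ 4 ℕ.* k)
4^suc-between k 2≤k with 4^-between k (ℕP.≤-trans (s≤s z≤n) 2≤k)
... | zero  , k≤1 , _ = ⊥-elim (ℕP.<⇒≱ 2≤k k≤1)
... | suc J , bounds  = J , bounds

within-± : ∀ {Q X r ℓ} → Q ≡ X ℕ.+ r → r ℕ.≤ ℓ → (+ Q - + ℓ ℤ.≤ + X) × (+ X ℤ.≤ + Q + + ℓ)
within-± {X = X} {r} {ℓ} refl r≤ℓ = lower , upper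
  where
  lower : + (X ℕ.+ r) - + ℓ ℤ.≤ + X
  lower = ℤP.≤-trans (ℤP.+-monoʳ-≤ (+ (X ℕ.+ r)) (ℤP.neg-mono-≤ (ℤ.+≤+ r≤ℓ)))
                     (ℤP.≤-reflexive (trans (cong (_- + r) (ℤP.pos-+ X r)) (cancel (+ X) (+ r))))
    where
    cancel : ∀ x y → (x + y) - y ≡ x
    cancel = solve-∀
  upper : + X ℤ.≤ + (X ℕ.+ r) + + ℓ
  upper = ℤP.≤-trans (ℤ.+≤+ (ℕP.≤-trans (ℕP.m≤m+n X r) (ℕP.m≤m+n (X ℕ.+ r) ℓ))) (ℤP.≤-reflexive (ℤP.pos-+ (X ℕ.+ r) ℓ))

-- Finite sums

∑ : ℕ → (ℕ → ℤ) → ℤ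
∑ zero    f = 0ℤ
∑ (suc n) f = f 0 + ∑ n (f ∘ suc)

∑ℕ : ℕ → (ℕ → ℕ) → ℕ
∑ℕ zero    f = 0
∑ℕ (suc n) f = f 0 ℕ.+ ∑ℕ n (f ∘ suc)

∑-cong : ∀ n {f g : ℕ → ℤ} → (∀ i → i ℕ.< n → f i ≡ g i) → ∑ n f ≡ ∑ n g
∑-cong zero    eq = refl
∑-cong (suc n) eq = cong₂ _+_ (eq 0 (s≤s z≤n)) (∑-cong n (λ i i<n → eq (suc i) (s≤s i<n)))

∑-zero : ∀ n {f : ℕ → ℤ} → (∀ i → i ℕ.< n → f i ≡ 0ℤ) → ∑ n f ≡ 0ℤ
∑-zero zero    eq = refl
∑-zero (suc n) eq = cong₂ _+_ (eq 0 (s≤s z≤n)) (∑-zero n (λ i i<n → eq (suc i) (s≤s i<n)))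

∑-distrib-+ : ∀ n (f g : ℕ → ℤ) → ∑ n (λ i → f i + g i) ≡ ∑ n f + ∑ n g
∑-distrib-+ zero    f g = refl
∑-distrib-+ (suc n) f g = begin
  (f 0 + g 0) + ∑ n (λ i → f (suc i) + g (suc i))     ≡⟨ cong (_+_ (f 0 + g 0)) (∑-distrib-+ n (f ∘ suc) (g ∘ suc)) ⟩
  (f 0 + g 0) + (∑ n (f ∘ suc) + ∑ n (g ∘ suc))     ≡⟨ medial (f 0) (g 0) _ _ ⟩
  (f 0 + ∑ n (f ∘ suc)) + (g 0 + ∑ n (g ∘ suc))     ∎
  where
  open ≡-Reasoning
  medial : ∀ a b c d → (a + b) + (c + d) ≡ (a + c) + (b + d)
  medial = solve-∀

∑-*ˡ : ∀ n c (f : ℕ → ℤ) → ∑ n (λ i → c * f i) ≡ c * ∑ n f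
∑-*ˡ zero    c f = sym (ℤP.*-zeroʳ c)
∑-*ˡ (suc n) c f = trans (cong (_+_ (c * f 0)) (∑-*ˡ n c (f ∘ suc))) (sym (ℤP.*-distribˡ-+ c (f 0) _))

∑-*ʳ : ∀ n c (f : ℕ → ℤ) → ∑ n (λ i → f i * c) ≡ ∑ n f * c
∑-*ʳ n c f = trans (∑-cong n (λ i _ → ℤP.*-comm (f i) c)) (trans (∑-*ˡ n c f) (ℤP.*-comm c (∑ n f)))

∑-last : ∀ n (f : ℕ → ℤ) → ∑ (suc n) f ≡ ∑ n f + f n
∑-last zero    f = ℤP.+-comm (f 0) 0ℤ
∑-last (suc n) f = trans (cong (_+_ (f 0)) (∑-last n (f ∘ suc))) (sym (ℤP.+-assoc (f 0) _ _))

∑-comm : ∀ m n (f : ℕ → ℕ → ℤ) → ∑ m (λ i → ∑ n (f i)) ≡ ∑ n (λ j → ∑ m (λ i → f i j))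
∑-comm zero    n f = sym (∑-zero n (λ _ _ → refl))
∑-comm (suc m) n f = trans (cong (_+_ (∑ n (f 0))) (∑-comm m n (f ∘ suc)))
                           (sym (∑-distrib-+ n (f 0) (λ j → ∑ m (λ i → f (suc i) j))))

∑-extend : ∀ m n (f : ℕ → ℤ) → m ℕ.≤ n → (∀ i → m ℕ.≤ i → i ℕ.< n → f i ≡ 0ℤ) → ∑ m f ≡ ∑ n f
∑-extend zero    n       f _         eq = sym (∑-zero n (λ i → eq i z≤n))
∑-extend (suc m) (suc n) f (s≤s m≤n) eq =
  cong (_+_ (f 0)) (∑-extend m n (f ∘ suc) m≤n (λ i m≤i i<n → eq (suc i) (s≤s m≤i) (s≤s i<n)))

∑-single : ∀ n s {f : ℕ → ℤ} → s ℕ.< n → (∀ i → i ℕ.< n → i ≢ s → f i ≡ 0ℤ) → ∑ n f ≡ f s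
∑-single (suc n) zero    {f} _         eq =
  trans (cong (_+_ (f 0)) (∑-zero n (λ i i<n → eq (suc i) (s≤s i<n) (λ ())))) (ℤP.+-identityʳ (f 0))
∑-single (suc n) (suc s) {f} (s≤s s<n) eq =
  trans (cong (_+ ∑ n (f ∘ suc)) (eq 0 (s≤s z≤n) (λ ())))
        (trans (ℤP.+-identityˡ _) (∑-single n s s<n (λ i i<n i≢s → eq (suc i) (s≤s i<n) (i≢s ∘ ℕP.suc-injective))))

∑-pos : ∀ n (f : ℕ → ℕ) → ∑ n (λ i → + f i) ≡ + ∑ℕ n f
∑-pos zero    f = refl
∑-pos (suc n) f = cong (_+_ (+ f 0)) (∑-pos n (f ∘ suc))

∣∑∣≤∑∣∣ : ∀ n (f : ℕ → ℤ) → ∣ ∑ n f ∣ ℕ.≤ ∑ℕ n (λ i → ∣ f i ∣)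
∣∑∣≤∑∣∣ zero    f = z≤n
∣∑∣≤∑∣∣ (suc n) f = ℕP.≤-trans (ℤP.∣i+j∣≤∣i∣+∣j∣ (f 0) (∑ n (f ∘ suc))) (ℕP.+-monoʳ-≤ ∣ f 0 ∣ (∣∑∣≤∑∣∣ n (f ∘ suc)))

Σℤ≡∑ : ∀ n (f : Fin n → ℤ) (g : ℕ → ℤ) → (∀ i → f i ≡ g (toℕ i)) → Σℤ n f ≡ ∑ n g
Σℤ≡∑ zero    f g eq = refl
Σℤ≡∑ (suc n) f g eq = cong₂ _+_ (eq Fin.zero) (trans (cong (foldr _+_ 0ℤ) tail≡) (Σℤ≡∑ n (f ∘ Fin.suc) (g ∘ suc) (eq ∘ Fin.suc)))
  where
  open import Data.List using (foldr; map; tabulate)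
  tail≡ : map f (tabulate Fin.suc) ≡ map (f ∘ Fin.suc) (tabulate (λ i → i))
  tail≡ = trans (ListP.map-tabulate Fin.suc f) (sym (ListP.map-tabulate (λ i → i) (f ∘ Fin.suc)))

∑ℕ-cong : ∀ n {f g : ℕ → ℕ} → (∀ i → i ℕ.< n → f i ≡ g i) → ∑ℕ n f ≡ ∑ℕ n g
∑ℕ-cong zero    eq = refl
∑ℕ-cong (suc n) eq = cong₂ ℕ._+_ (eq 0 (s≤s z≤n)) (∑ℕ-cong n (λ i i<n → eq (suc i) (s≤s i<n)))

∑ℕ-mono-≤ : ∀ n {f g : ℕ → ℕ} → (∀ i → i ℕ.< n → f i ℕ.≤ g i) → ∑ℕ n f ℕ.≤ ∑ℕ n g
∑ℕ-mono-≤ zero    le = z≤n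
∑ℕ-mono-≤ (suc n) le = ℕP.+-mono-≤ (le 0 (s≤s z≤n)) (∑ℕ-mono-≤ n (λ i i<n → le (suc i) (s≤s i<n)))

∑ℕ-last : ∀ n (f : ℕ → ℕ) → ∑ℕ (suc n) f ≡ ∑ℕ n f ℕ.+ f n
∑ℕ-last zero    f = ℕP.+-comm (f 0) 0
∑ℕ-last (suc n) f = trans (cong (f 0 ℕ.+_) (∑ℕ-last n (f ∘ suc))) (sym (ℕP.+-assoc (f 0) _ _))

∑ℕ≤∑ℕ-suc : ∀ n (f : ℕ → ℕ) → ∑ℕ n f ℕ.≤ ∑ℕ (suc n) f
∑ℕ≤∑ℕ-suc n f = ℕP.≤-trans (ℕP.m≤m+n (∑ℕ n f) (f n)) (ℕP.≤-reflexive (sym (∑ℕ-last n f)))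

∑ℕ-const : ∀ n c → ∑ℕ n (λ _ → c) ≡ n ℕ.* c
∑ℕ-const zero    c = refl
∑ℕ-const (suc n) c = cong (c ℕ.+_) (∑ℕ-const n c)

∑ℕ-*ʳ : ∀ n c (f : ℕ → ℕ) → ∑ℕ n (λ i → f i ℕ.* c) ≡ ∑ℕ n f ℕ.* c
∑ℕ-*ʳ zero    c f = refl
∑ℕ-*ʳ (suc n) c f = trans (cong (f 0 ℕ.* c ℕ.+_) (∑ℕ-*ʳ n c (f ∘ suc))) (sym (ℕP.*-distribʳ-+ c (f 0) _))

term≤∑ℕ : ∀ n (f : ℕ → ℕ) i → i ℕ.< n → f i ℕ.≤ ∑ℕ n f
term≤∑ℕ (suc n) f zero    _         = ℕP.m≤m+n (f 0) _
term≤∑ℕ (suc n) f (suc i) (s≤s i<n) = ℕP.≤-trans (term≤∑ℕ n (f ∘ suc) i i<n) (ℕP.m≤n+m _ (f 0))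

opaque
  kronecker : ℕ → ℕ → ℤ
  kronecker a b with a ℕ.≟ b
  ... | yes _ = 1ℤ
  ... | no  _ = 0ℤ

  kronecker-refl : ∀ a → kronecker a a ≡ 1ℤ
  kronecker-refl a with a ℕ.≟ a
  ... | yes _   = refl
  ... | no  a≢a = ⊥-elim (a≢a refl)

  kronecker-≢ : ∀ {a b} → a ≢ b → kronecker a b ≡ 0ℤ
  kronecker-≢ {a} {b} a≢b with a ℕ.≟ b
  ... | yes a≡b = ⊥-elim (a≢b a≡b)
  ... | no  _   = refl

  kronecker≢0⇒≡ : ∀ a b → kronecker a b ≢ 0ℤ → a ≡ b
  kronecker≢0⇒≡ a b δ≢0 with a ℕ.≟ b
  ... | yes a≡b = a≡b
  ... | no  _   = ⊥-elim (δ≢0 refl)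

∑-kronecker : ∀ n a (f : ℕ → ℤ) → a ℕ.< n → ∑ n (λ x → kronecker a x * f x) ≡ f a
∑-kronecker n a f a<n = begin
  ∑ n (λ x → kronecker a x * f x) ≡⟨ ∑-single n a a<n (λ x _ x≢a → cong (_* f x) (kronecker-≢ (x≢a ∘ sym))) ⟩
  kronecker a a * f a             ≡⟨ cong (_* f a) (kronecker-refl a) ⟩
  1ℤ * f a                        ≡⟨ ℤP.*-identityˡ (f a) ⟩
  f a                             ∎
  where open ≡-Reasoning

kronecker-suc : ∀ a b → kronecker (suc a) (suc b) ≡ kronecker a b
kronecker-suc a b with a ℕ.≟ b
... | yes refl = trans (kronecker-refl (suc a)) (sym (kronecker-refl a))
... | no  a≢b  = trans (kronecker-≢ (a≢b ∘ ℕP.suc-injective)) (sym (kronecker-≢ a≢b))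

∑-kronecker-suc : ∀ n a (f : ℕ → ℤ) → 1 ℕ.≤ a → a ℕ.≤ n → ∑ n (λ x → kronecker a (suc x) * f (suc x)) ≡ f a
∑-kronecker-suc n (suc a) f _ a<n =
  trans (∑-cong n (λ x _ → cong (_* f (suc x)) (kronecker-suc a x))) (∑-kronecker n a (f ∘ suc) a<n)

∣∑-kronecker∣≤ : ∀ n (a : ℕ → ℤ) (g : ℕ → ℕ) y {M} → (∀ i j → g i ≡ g j → i ≡ j) → (∀ j → j ℕ.< n → ∣ a j ∣ ℕ.≤ M) →
  ∣ ∑ n (λ j → a j * kronecker (g j) y) ∣ ℕ.≤ M
∣∑-kronecker∣≤ zero a g y g-inj a≤M = z≤n
∣∑-kronecker∣≤ (suc n) a g y g-inj a≤M rewrite ∑-last n (λ j → a j * kronecker (g j) y) with g n ℕ.≟ y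
... | yes refl = ℕP.≤-trans (ℕP.≤-reflexive (cong ∣_∣ earlier+last)) (a≤M n ℕP.≤-refl)
  where
  earlier+last : ∑ n (λ j → a j * kronecker (g j) (g n)) + a n * kronecker (g n) (g n) ≡ a n
  earlier+last = begin
    ∑ n (λ j → a j * kronecker (g j) (g n)) + a n * kronecker (g n) (g n)
      ≡⟨ cong₂ _+_ (∑-zero n (λ j j<n → trans (cong (a j *_) (kronecker-≢ (λ e → ℕP.<-irrefl (g-inj j n e) j<n))) (ℤP.*-zeroʳ (a j))))
                   (cong (a n *_) (kronecker-refl (g n))) ⟩
    0ℤ + a n * 1ℤ ≡⟨ trans (ℤP.+-identityˡ _) (ℤP.*-identityʳ (a n)) ⟩
    a n ∎
    where open ≡-Reasoning
... | no gn≢y = ℕP.≤-trans (ℕP.≤-reflexive (cong ∣_∣ last-vanishes))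
                  (∣∑-kronecker∣≤ n a g y g-inj (λ j j<n → a≤M j (ℕP.m≤n⇒m≤1+n j<n)))
  where
  last-vanishes : ∑ n (λ j → a j * kronecker (g j) y) + a n * kronecker (g n) y ≡ ∑ n (λ j → a j * kronecker (g j) y)
  last-vanishes = trans (cong (_+_ (∑ n (λ j → a j * kronecker (g j) y))) (trans (cong (a n *_) (kronecker-≢ gn≢y)) (ℤP.*-zeroʳ (a n))))
                        (ℤP.+-identityʳ _)

∑≢0⇒∃term≢0 : ∀ n (f : ℕ → ℤ) → ∑ n f ≢ 0ℤ → ∃[ j ] (j ℕ.< n × f j ≢ 0ℤ)
∑≢0⇒∃term≢0 zero    f ∑≢0 = ⊥-elim (∑≢0 refl)
∑≢0⇒∃term≢0 (suc n) f ∑≢0 with f 0 ℤP.≟ 0ℤ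
... | no  f0≢0 = 0 , s≤s z≤n , f0≢0
... | yes f0≡0 with ∑≢0⇒∃term≢0 n (f ∘ suc) (λ ∑≡0 → ∑≢0 (cong₂ _+_ f0≡0 ∑≡0))
... | j , j<n , fj≢0 = suc j , s≤s j<n , fj≢0

-- Greedy expansion in a mixed radix

override : ∀ {A : Set} → (ℕ → A) → ℕ → A → ℕ → A
override f t a j with j ℕ.≟ t
... | yes _ = a
... | no  _ = f j

override-≡ : ∀ {A : Set} (f : ℕ → A) t a → override f t a t ≡ a
override-≡ f t a with t ℕ.≟ t
... | yes _   = refl
... | no  t≢t = ⊥-elim (t≢t refl)

override-≢ : ∀ {A : Set} (f : ℕ → A) t a {j} → j ≢ t → override f t a j ≡ f j
override-≢ f t a {j} j≢t with j ℕ.≟ t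
... | yes j≡t = ⊥-elim (j≢t j≡t)
... | no  _   = refl

override-pointwise : ∀ {A : Set} (P : A → Set) (f : ℕ → A) t a → (∀ j → P (f j)) → P a → ∀ j → P (override f t a j)
override-pointwise P f t a Pf Pa j with j ℕ.≟ t
... | yes _ = Pa
... | no  _ = Pf j

∑ℕ-override-last : ∀ {A : Set} n (F : ℕ → A → ℕ) (f : ℕ → A) a →
  ∑ℕ (suc n) (λ j → F j (override f n a j)) ≡ ∑ℕ n (λ j → F j (f j)) ℕ.+ F n a
∑ℕ-override-last n F f a = trans (∑ℕ-last n (λ j → F j (override f n a j)))
  (cong₂ ℕ._+_ (∑ℕ-cong n (λ j j<n → cong (F j) (override-≢ f n a (ℕP.<⇒≢ j<n)))) (cong (F n) (override-≡ f n a)))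

divMod-bounded : ∀ R b c → 1 ℕ.≤ b → R ℕ.< c ℕ.* b → Σ[ q ∈ ℕ ] Σ[ r ∈ ℕ ] (R ≡ r ℕ.+ q ℕ.* b) × r ℕ.< b × q ℕ.≤ c
divMod-bounded R b@(suc _) c _ R<cb =
  R ℕ./ b , R ℕ.% b , m≡m%n+[m/n]*n R b , m%n<n R b , ℕP.<⇒≤ (m<n*o⇒m/o<n {R} {c} {b} R<cb)
  where open import Data.Nat.DivMod using (m≡m%n+[m/n]*n; m%n<n; m<n*o⇒m/o<n)

move-remainder : ∀ S r x → x ℕ.+ (S ℕ.+ r) ≡ (S ℕ.+ x) ℕ.+ r
move-remainder = ℕSolver.solve-∀

-- Opaque so that the digits, which are computed by division, are never unfolded during unification.
opaque
  greedy-expansion : ∀ N (b : ℕ → ℕ) c R → (∀ j → j ℕ.≤ N → 1 ℕ.≤ b j) → (∀ j → j ℕ.< N → b (suc j) ℕ.≤ c ℕ.* b j) →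
    R ℕ.< c ℕ.* b N →
    Σ[ δ ∈ (ℕ → ℕ) ] Σ[ r ∈ ℕ ] (R ≡ ∑ℕ (suc N) (λ j → δ j ℕ.* b j) ℕ.+ r) × r ℕ.< b 0 × (∀ j → δ j ℕ.≤ c)
  greedy-expansion zero b c R b≥1 _ R<cb with divMod-bounded R (b 0) c (b≥1 0 z≤n) R<cb
  ... | q , r , R≡ , r<b , q≤c = (λ _ → q) , r , trans R≡ (trans (ℕP.+-comm r _) (cong (ℕ._+ r) (sym (ℕP.+-identityʳ _)))) , r<b , (λ _ → q≤c)
  greedy-expansion (suc N) b c R b≥1 ratio R<cb with divMod-bounded R (b (suc N)) c (b≥1 (suc N) ℕP.≤-refl) R<cb
  ... | q , r , R≡ , r<b , q≤c with greedy-expansion N b c r (λ j j≤N → b≥1 j (ℕP.m≤n⇒m≤1+n j≤N))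
                                     (λ j j<N → ratio j (ℕP.m≤n⇒m≤1+n j<N)) (ℕP.<-≤-trans r<b (ratio N ℕP.≤-refl))
  ... | δ , r′ , r≡ , r′<b , δ≤c =
    override δ (suc N) q , r′ , R≡′ , r′<b , override-pointwise (ℕ._≤ c) δ (suc N) q δ≤c q≤c
    where
    open ≡-Reasoning
    R≡′ : R ≡ ∑ℕ (suc (suc N)) (λ j → override δ (suc N) q j ℕ.* b j) ℕ.+ r′
    R≡′ = begin
      R                                                              ≡⟨ trans R≡ (ℕP.+-comm r _) ⟩
      q ℕ.* b (suc N) ℕ.+ r                                          ≡⟨ cong (q ℕ.* b (suc N) ℕ.+_) r≡ ⟩
      q ℕ.* b (suc N) ℕ.+ (∑ℕ (suc N) (λ j → δ j ℕ.* b j) ℕ.+ r′)    ≡⟨ move-remainder (∑ℕ (suc N) (λ j → δ j ℕ.* b j)) r′ (q ℕ.* b (suc N)) ⟩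
      (∑ℕ (suc N) (λ j → δ j ℕ.* b j) ℕ.+ q ℕ.* b (suc N)) ℕ.+ r′    ≡⟨ cong (ℕ._+ r′) (∑ℕ-override-last (suc N) (λ j x → x ℕ.* b j) δ q) ⟨
      ∑ℕ (suc (suc N)) (λ j → override δ (suc N) q j ℕ.* b j) ℕ.+ r′ ∎

  greedy-expansion² : ∀ L N (b : ℕ → ℕ → ℕ) c R →
    (∀ i j → i ℕ.≤ L → j ℕ.≤ N → 1 ℕ.≤ b i j) →
    (∀ i j → i ℕ.≤ L → j ℕ.< N → b i (suc j) ℕ.≤ c ℕ.* b i j) →
    (∀ i → i ℕ.< L → b (suc i) 0 ℕ.≤ c ℕ.* b i N) →
    R ℕ.< c ℕ.* b L N →
    Σ[ δ ∈ (ℕ → ℕ → ℕ) ] Σ[ r ∈ ℕ ]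
      (R ≡ ∑ℕ (suc L) (λ i → ∑ℕ (suc N) (λ j → δ i j ℕ.* b i j)) ℕ.+ r) × r ℕ.< b 0 0 × (∀ i j → δ i j ℕ.≤ c)
  greedy-expansion² zero N b c R b≥1 ratio _ R<cb
    with greedy-expansion N (b 0) c R (λ j → b≥1 0 j z≤n) (λ j → ratio 0 j z≤n) R<cb
  ... | δ , r , R≡ , r<b , δ≤c = (λ _ → δ) , r , trans R≡ (cong (ℕ._+ r) (sym (ℕP.+-identityʳ _))) , r<b , (λ _ → δ≤c)
  greedy-expansion² (suc L) N b c R b≥1 ratio step R<cb
    with greedy-expansion N (b (suc L)) c R (λ j → b≥1 (suc L) j ℕP.≤-refl) (λ j → ratio (suc L) j ℕP.≤-refl) R<cb
  ... | δₗ , r , R≡ , r<b , δₗ≤c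
    with greedy-expansion² L N b c r (λ i j i≤L → b≥1 i j (ℕP.m≤n⇒m≤1+n i≤L)) (λ i j i≤L → ratio i j (ℕP.m≤n⇒m≤1+n i≤L))
                                       (λ i i<L → step i (ℕP.m≤n⇒m≤1+n i<L)) (ℕP.<-≤-trans r<b (step L ℕP.≤-refl))
  ... | δ , r′ , r≡ , r′<b , δ≤c =
    override δ (suc L) δₗ , r′ , R≡′ , r′<b , override-pointwise (λ f → ∀ j → f j ℕ.≤ c) δ (suc L) δₗ δ≤c δₗ≤c
    where
    open ≡-Reasoning
    row : ℕ → (ℕ → ℕ) → ℕ
    row i f = ∑ℕ (suc N) (λ j → f j ℕ.* b i j)
    R≡′ : R ≡ ∑ℕ (suc (suc L)) (λ i → row i (override δ (suc L) δₗ i)) ℕ.+ r′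
    R≡′ = begin
      R                                                          ≡⟨ R≡ ⟩
      row (suc L) δₗ ℕ.+ r                                       ≡⟨ cong (row (suc L) δₗ ℕ.+_) r≡ ⟩
      row (suc L) δₗ ℕ.+ (∑ℕ (suc L) (λ i → row i (δ i)) ℕ.+ r′)  ≡⟨ move-remainder (∑ℕ (suc L) (λ i → row i (δ i))) r′ (row (suc L) δₗ) ⟩
      (∑ℕ (suc L) (λ i → row i (δ i)) ℕ.+ row (suc L) δₗ) ℕ.+ r′  ≡⟨ cong (ℕ._+ r′) (∑ℕ-override-last (suc L) row δ δₗ) ⟨
      ∑ℕ (suc (suc L)) (λ i → row i (override δ (suc L) δₗ i)) ℕ.+ r′ ∎

-- Integer polynomials as coefficient lists

⟪_,_⟫ : List ℤ → (ℕ → ℤ) → ℤ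
⟪ []    , g ⟫ = 0ℤ
⟪ a ∷ P , g ⟫ = a * g 0 + ⟪ P , g ∘ suc ⟫

evalᴸ : List ℤ → ℤ → ℤ
evalᴸ P x = ⟪ P , x ^_ ⟫

⟪⟫-cong : ∀ P {f g : ℕ → ℤ} → (∀ e → e ℕ.< length P → f e ≡ g e) → ⟪ P , f ⟫ ≡ ⟪ P , g ⟫
⟪⟫-cong []      eq = refl
⟪⟫-cong (a ∷ P) eq = cong₂ (λ u v → a * u + v) (eq 0 (s≤s z≤n)) (⟪⟫-cong P (λ e e< → eq (suc e) (s≤s e<)))

⟪⟫-zero : ∀ P {g : ℕ → ℤ} → (∀ e → g e ≡ 0ℤ) → ⟪ P , g ⟫ ≡ 0ℤ
⟪⟫-zero []      eq = refl
⟪⟫-zero (a ∷ P) eq = trans (cong₂ (λ u v → a * u + v) (eq 0) (⟪⟫-zero P (eq ∘ suc))) (trans (ℤP.+-identityʳ _) (ℤP.*-zeroʳ a))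

⟪⟫-*ˡ : ∀ P c (g : ℕ → ℤ) → ⟪ P , (λ e → c * g e) ⟫ ≡ c * ⟪ P , g ⟫
⟪⟫-*ˡ []      c g = sym (ℤP.*-zeroʳ c)
⟪⟫-*ˡ (a ∷ P) c g = trans (cong (_+_ (a * (c * g 0))) (⟪⟫-*ˡ P c (g ∘ suc))) (pull a c (g 0) _)
  where
  pull : ∀ a c x u → a * (c * x) + c * u ≡ c * (a * x + u)
  pull = solve-∀

⟪⟫-*ʳ : ∀ P c (g : ℕ → ℤ) → ⟪ P , (λ e → g e * c) ⟫ ≡ ⟪ P , g ⟫ * c
⟪⟫-*ʳ P c g = trans (⟪⟫-cong P (λ e _ → ℤP.*-comm (g e) c)) (trans (⟪⟫-*ˡ P c g) (ℤP.*-comm c _))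

⟪⟫-∑ : ∀ P n (f : ℕ → ℕ → ℤ) → ⟪ P , (λ e → ∑ n (λ r → f r e)) ⟫ ≡ ∑ n (λ r → ⟪ P , f r ⟫)
⟪⟫-∑ []      n f = sym (∑-zero n (λ _ _ → refl))
⟪⟫-∑ (a ∷ P) n f = begin
  a * ∑ n (λ r → f r 0) + ⟪ P , (λ e → ∑ n (λ r → f r (suc e))) ⟫
    ≡⟨ cong₂ _+_ (sym (∑-*ˡ n a (λ r → f r 0))) (⟪⟫-∑ P n (λ r → f r ∘ suc)) ⟩
  ∑ n (λ r → a * f r 0) + ∑ n (λ r → ⟪ P , f r ∘ suc ⟫)
    ≡⟨ sym (∑-distrib-+ n (λ r → a * f r 0) (λ r → ⟪ P , f r ∘ suc ⟫)) ⟩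
  ∑ n (λ r → ⟪ a ∷ P , f r ⟫) ∎
  where open ≡-Reasoning

∑∣∣ᴸ : List ℤ → ℕ
∑∣∣ᴸ []      = 0
∑∣∣ᴸ (a ∷ P) = ∣ a ∣ ℕ.+ ∑∣∣ᴸ P

∣⟪⟫∣≤ : ∀ P (g : ℕ → ℤ) {M} → (∀ e → ∣ g e ∣ ℕ.≤ M) → ∣ ⟪ P , g ⟫ ∣ ℕ.≤ ∑∣∣ᴸ P ℕ.* M
∣⟪⟫∣≤ []      g g≤M = z≤n
∣⟪⟫∣≤ (a ∷ P) g {M} g≤M = begin
  ∣ a * g 0 + ⟪ P , g ∘ suc ⟫ ∣             ≤⟨ ℤP.∣i+j∣≤∣i∣+∣j∣ (a * g 0) _ ⟩
  ∣ a * g 0 ∣ ℕ.+ ∣ ⟪ P , g ∘ suc ⟫ ∣        ≤⟨ ℕP.+-mono-≤ (ℕP.≤-trans (ℕP.≤-reflexive (ℤP.abs-* a (g 0))) (ℕP.*-monoʳ-≤ ∣ a ∣ (g≤M 0)))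
                                                           (∣⟪⟫∣≤ P (g ∘ suc) (g≤M ∘ suc)) ⟩
  ∣ a ∣ ℕ.* M ℕ.+ ∑∣∣ᴸ P ℕ.* M               ≡⟨ ℕP.*-distribʳ-+ M ∣ a ∣ (∑∣∣ᴸ P) ⟨
  ∑∣∣ᴸ (a ∷ P) ℕ.* M                          ∎
  where open ℕP.≤-Reasoning

_+ᴸ_ : List ℤ → List ℤ → List ℤ
[]      +ᴸ Q       = Q
(a ∷ P) +ᴸ []      = a ∷ P
(a ∷ P) +ᴸ (b ∷ Q) = (a + b) ∷ (P +ᴸ Q)

_·ᴸ_ : ℤ → List ℤ → List ℤ
c ·ᴸ []      = []
c ·ᴸ (a ∷ P) = (c * a) ∷ (c ·ᴸ P)

_*ᴸ_ : List ℤ → List ℤ → List ℤ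
[]      *ᴸ Q = []
(a ∷ P) *ᴸ Q = (a ·ᴸ Q) +ᴸ (0ℤ ∷ (P *ᴸ Q))

⟪+ᴸ⟫ : ∀ P Q g → ⟪ P +ᴸ Q , g ⟫ ≡ ⟪ P , g ⟫ + ⟪ Q , g ⟫
⟪+ᴸ⟫ []      Q       g = sym (ℤP.+-identityˡ _)
⟪+ᴸ⟫ (a ∷ P) []      g = sym (ℤP.+-identityʳ _)
⟪+ᴸ⟫ (a ∷ P) (b ∷ Q) g = trans (cong (_+_ ((a + b) * g 0)) (⟪+ᴸ⟫ P Q (g ∘ suc))) (medial a b (g 0) _ _)
  where
  medial : ∀ a b x u v → (a + b) * x + (u + v) ≡ (a * x + u) + (b * x + v)
  medial = solve-∀

⟪·ᴸ⟫ : ∀ c P g → ⟪ c ·ᴸ P , g ⟫ ≡ c * ⟪ P , g ⟫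
⟪·ᴸ⟫ c []      g = sym (ℤP.*-zeroʳ c)
⟪·ᴸ⟫ c (a ∷ P) g = trans (cong (_+_ (c * a * g 0)) (⟪·ᴸ⟫ c P (g ∘ suc))) (pull c a (g 0) _)
  where
  pull : ∀ c a x u → (c * a) * x + c * u ≡ c * (a * x + u)
  pull = solve-∀

evalᴸ-*ᴸ : ∀ P Q x → evalᴸ (P *ᴸ Q) x ≡ evalᴸ P x * evalᴸ Q x
evalᴸ-*ᴸ []      Q x = refl
evalᴸ-*ᴸ (a ∷ P) Q x = begin
  ⟪ (a ·ᴸ Q) +ᴸ (0ℤ ∷ (P *ᴸ Q)) , x ^_ ⟫                        ≡⟨ ⟪+ᴸ⟫ (a ·ᴸ Q) _ (x ^_) ⟩
  ⟪ a ·ᴸ Q , x ^_ ⟫ + (0ℤ * 1ℤ + ⟪ P *ᴸ Q , (λ e → x * x ^ e) ⟫)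
    ≡⟨ cong₂ (λ u v → u + (0ℤ * 1ℤ + v)) (⟪·ᴸ⟫ a Q (x ^_)) (trans (⟪⟫-*ˡ (P *ᴸ Q) x (x ^_)) (cong (x *_) (evalᴸ-*ᴸ P Q x))) ⟩
  a * evalᴸ Q x + (0ℤ * 1ℤ + x * (evalᴸ P x * evalᴸ Q x))        ≡⟨ collect a (evalᴸ Q x) x (evalᴸ P x) ⟩
  (a * 1ℤ + x * evalᴸ P x) * evalᴸ Q x                            ≡⟨ cong (λ u → (a * 1ℤ + u) * evalᴸ Q x) (sym (⟪⟫-*ˡ P x (x ^_))) ⟩
  evalᴸ (a ∷ P) x * evalᴸ Q x                                     ∎
  where
  open ≡-Reasoning
  collect : ∀ a q x e → a * q + (0ℤ * 1ℤ + x * (e * q)) ≡ (a * 1ℤ + x * e) * q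
  collect = solve-∀

-- Polynomials vanishing at 2, 4, …, 2ⁿ except at 2ˢ

2^ℤ : ℕ → ℤ
2^ℤ r = + (2 ℕ.^ r)

-- ±(X − 2ʳ), signed to be positive at X = 2ˢ, and the constant 1 when r = s.
opaque
  linearFactor : ℕ → ℕ → List ℤ
  linearFactor s r with ℕP.<-cmp r s
  ... | tri< _ _ _ = (- 2^ℤ r) ∷ 1ℤ ∷ []
  ... | tri≈ _ _ _ = 1ℤ ∷ []
  ... | tri> _ _ _ = 2^ℤ r ∷ (- 1ℤ) ∷ []

  linearFactorValue : ℕ → ℕ → ℕ
  linearFactorValue s r with ℕP.<-cmp r s
  ... | tri< _ _ _ = 2 ℕ.^ s ℕ.∸ 2 ℕ.^ r
  ... | tri≈ _ _ _ = 1
  ... | tri> _ _ _ = 2 ℕ.^ r ℕ.∸ 2 ℕ.^ s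

  eval-X-a : ∀ a x → evalᴸ (- a ∷ 1ℤ ∷ []) x ≡ x - a
  eval-X-a a x = normalise a x
    where
    normalise : ∀ a x → - a * 1ℤ + (1ℤ * (x * 1ℤ) + 0ℤ) ≡ x - a
    normalise = solve-∀

  eval-a-X : ∀ a x → evalᴸ (a ∷ - 1ℤ ∷ []) x ≡ a - x
  eval-a-X a x = normalise a x
    where
    normalise : ∀ a x → a * 1ℤ + (- 1ℤ * (x * 1ℤ) + 0ℤ) ≡ a - x
    normalise = solve-∀

  2^ℤ-∸ : ∀ {r s} → r ℕ.< s → 2^ℤ s - 2^ℤ r ≡ + (2 ℕ.^ s ℕ.∸ 2 ℕ.^ r)
  2^ℤ-∸ {r} {s} r<s = trans (ℤP.[+m]-[+n]≡m⊖n (2 ℕ.^ s) (2 ℕ.^ r)) (ℤP.⊖-≥ (ℕP.<⇒≤ (2^-monoʳ-< r<s)))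

  linearFactor-root : ∀ s r → r ≢ s → evalᴸ (linearFactor s r) (2^ℤ r) ≡ 0ℤ
  linearFactor-root s r r≢s with ℕP.<-cmp r s
  ... | tri< _ _ _   = trans (eval-X-a (2^ℤ r) (2^ℤ r)) (ℤP.+-inverseʳ (2^ℤ r))
  ... | tri≈ _ r≡s _ = ⊥-elim (r≢s r≡s)
  ... | tri> _ _ _   = trans (eval-a-X (2^ℤ r) (2^ℤ r)) (ℤP.+-inverseʳ (2^ℤ r))

  linearFactor-value : ∀ s r → evalᴸ (linearFactor s r) (2^ℤ s) ≡ + linearFactorValue s r
  linearFactor-value s r with ℕP.<-cmp r s
  ... | tri< r<s _ _ = trans (eval-X-a (2^ℤ r) (2^ℤ s)) (2^ℤ-∸ r<s)
  ... | tri≈ _ _ _   = refl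
  ... | tri> _ _ s<r = trans (eval-a-X (2^ℤ r) (2^ℤ s)) (2^ℤ-∸ s<r)

  1≤linearFactorValue : ∀ s r → 1 ℕ.≤ linearFactorValue s r
  1≤linearFactorValue s r with ℕP.<-cmp r s
  ... | tri< r<s _ _ = ℕP.m<n⇒0<n∸m (2^-monoʳ-< r<s)
  ... | tri≈ _ _ _   = ℕP.≤-refl
  ... | tri> _ _ s<r = ℕP.m<n⇒0<n∸m (2^-monoʳ-< s<r)

isolator : ℕ → ℕ → List ℤ
isolator s zero    = 1ℤ ∷ []
isolator s (suc n) = linearFactor s (suc n) *ᴸ isolator s n

isolatorValue : ℕ → ℕ → ℕ
isolatorValue s zero    = 1
isolatorValue s (suc n) = linearFactorValue s (suc n) ℕ.* isolatorValue s n

isolator-root : ∀ s n r → 1 ℕ.≤ r → r ℕ.≤ n → r ≢ s → evalᴸ (isolator s n) (2^ℤ r) ≡ 0ℤ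
isolator-root s (suc n) r 1≤r r≤n+1 r≢s with r ℕ.≟ suc n
... | yes refl = trans (evalᴸ-*ᴸ (linearFactor s r) (isolator s n) (2^ℤ r))
                       (trans (cong (_* evalᴸ (isolator s n) (2^ℤ r)) (linearFactor-root s r r≢s)) (ℤP.*-zeroˡ (evalᴸ (isolator s n) (2^ℤ r))))
... | no  r≢n+1 = trans (evalᴸ-*ᴸ (linearFactor s (suc n)) (isolator s n) (2^ℤ r))
                        (trans (cong (evalᴸ (linearFactor s (suc n)) (2^ℤ r) *_) (isolator-root s n r 1≤r (ℕP.≤-pred (ℕP.≤∧≢⇒< r≤n+1 r≢n+1)) r≢s))
                               (ℤP.*-zeroʳ (evalᴸ (linearFactor s (suc n)) (2^ℤ r))))
isolator-root s zero (suc r) _ () _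

isolator-value : ∀ s n → evalᴸ (isolator s n) (2^ℤ s) ≡ + isolatorValue s n
isolator-value s zero    = refl
isolator-value s (suc n) = begin
  evalᴸ (linearFactor s (suc n) *ᴸ isolator s n) (2^ℤ s)                  ≡⟨ evalᴸ-*ᴸ (linearFactor s (suc n)) (isolator s n) (2^ℤ s) ⟩
  evalᴸ (linearFactor s (suc n)) (2^ℤ s) * evalᴸ (isolator s n) (2^ℤ s)   ≡⟨ cong₂ _*_ (linearFactor-value s (suc n)) (isolator-value s n) ⟩
  + linearFactorValue s (suc n) * + isolatorValue s n                     ≡⟨ ℤP.pos-* (linearFactorValue s (suc n)) _ ⟨
  + isolatorValue s (suc n)                                               ∎
  where open ≡-Reasoning

1≤isolatorValue : ∀ s n → 1 ℕ.≤ isolatorValue s n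
1≤isolatorValue s zero    = ℕP.≤-refl
1≤isolatorValue s (suc n) = ℕP.*-mono-≤ (1≤linearFactorValue s (suc n)) (1≤isolatorValue s n)

-- Taylor expansion of p at k

opaque
  coeff : Poly → ℕ → ℤ
  coeff p e with e ℕ.<? suc (deg p)
  ... | yes e≤d = coef p (Fin.fromℕ< e≤d)
  ... | no  _   = 0ℤ

  coeff-toℕ : ∀ p (i : Fin (suc (deg p))) → coeff p (toℕ i) ≡ coef p i
  coeff-toℕ p i with toℕ i ℕ.<? suc (deg p)
  ... | yes i≤d = cong (coef p) (FinP.fromℕ<-toℕ i i≤d)
  ... | no  i≰d = ⊥-elim (i≰d (FinP.toℕ<n i))

coeff-deg : ∀ p → coeff p (deg p) ≡ leading p
coeff-deg p = trans (cong (coeff p) (sym (FinP.toℕ-fromℕ (deg p)))) (coeff-toℕ p (Fin.fromℕ (deg p)))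

eval-∑ : ∀ p z → eval p z ≡ ∑ (suc (deg p)) (λ e → coeff p e * z ^ e)
eval-∑ p z = Σℤ≡∑ (suc (deg p)) _ (λ e → coeff p e * z ^ e) (λ i → cong (_* z ^ toℕ i) (sym (coeff-toℕ p i)))

binomial-theorem : ∀ e (x y : ℤ) → (x + y) ^ e ≡ ∑ (suc e) (λ r → + (e C r) * (x ^ r * y ^ (e ℕ.∸ r)))
binomial-theorem e x y =
  trans (sym (^≡ (x + y) e)) (trans (Binomial.theorem e x y) (sum≡∑ (suc e) _ (λ r → + (e C r) * (x ^ r * y ^ (e ℕ.∸ r))) (λ i → trans (×≡ _ (e C toℕ i))
        (cong (+ (e C toℕ i) *_) (cong₂ _*_ (^≡ x (toℕ i)) (^≡ y (e ℕ.∸ toℕ i)))))))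
  where
  import Algebra.Properties.CommutativeSemiring.Binomial ℤP.+-*-commutativeSemiring as Binomial
  open import Algebra.Bundles using (CommutativeSemiring)
  open CommutativeSemiring ℤP.+-*-commutativeSemiring using (+-rawMonoid; *-rawMonoid)
  import Algebra.Definitions.RawMonoid as RawMonoid
  ^≡ : ∀ (x : ℤ) n → RawMonoid._×_ *-rawMonoid n x ≡ x ^ n
  ^≡ x zero    = refl
  ^≡ x (suc n) = cong (x *_) (^≡ x n)
  ×≡ : ∀ (x : ℤ) n → RawMonoid._×_ +-rawMonoid n x ≡ + n * x
  ×≡ x zero    = refl
  ×≡ x (suc n) = trans (cong (_+_ x) (×≡ x n)) (sym (trans (ℤP.*-distribʳ-+ x 1ℤ (+ n)) (cong (_+ + n * x) (ℤP.*-identityˡ x))))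
  sum≡∑ : ∀ n (f : Fin n → ℤ) (g : ℕ → ℤ) → (∀ i → f i ≡ g (toℕ i)) → RawMonoid.sum +-rawMonoid f ≡ ∑ n g
  sum≡∑ zero    f g eq = refl
  sum≡∑ (suc n) f g eq = cong₂ _+_ (eq Fin.zero) (sum≡∑ n (f ∘ Fin.suc) (g ∘ suc) (eq ∘ Fin.suc))

taylorTerm : Poly → ℕ → ℕ → ℕ → ℤ
taylorTerm p k s e = coeff p e * (+ (e C s) * (+ k) ^ (e ℕ.∸ s))

taylorCoeff : Poly → ℕ → ℕ → ℤ
taylorCoeff p k s = ∑ (suc (deg p)) (taylorTerm p k s)

eval-shift : ∀ p k x → eval p (+ k + + x) ≡ ∑ (suc (deg p)) (λ s → taylorCoeff p k s * (+ x) ^ s)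
eval-shift p k x = begin
  eval p (+ k + + x)                                             ≡⟨ eval-∑ p _ ⟩
  ∑ (suc d) (λ e → coeff p e * (+ k + + x) ^ e)                  ≡⟨ ∑-cong (suc d) expand ⟩
  ∑ (suc d) (λ e → ∑ (suc d) (λ s → taylorTerm p k s e * X s))   ≡⟨ ∑-comm (suc d) (suc d) (λ e s → taylorTerm p k s e * X s) ⟩
  ∑ (suc d) (λ s → ∑ (suc d) (λ e → taylorTerm p k s e * X s))   ≡⟨ ∑-cong (suc d) (λ s _ → ∑-*ʳ (suc d) (X s) (taylorTerm p k s)) ⟩
  ∑ (suc d) (λ s → taylorCoeff p k s * X s)                      ∎
  where
  open ≡-Reasoning
  d : ℕ
  d = deg p
  X : ℕ → ℤ
  X s = (+ x) ^ s
  rearrange : ∀ a c u v → a * (c * (u * v)) ≡ (a * (c * v)) * u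
  rearrange = solve-∀
  binomial-term : ℕ → ℕ → ℤ
  binomial-term e s = + (e C s) * (X s * (+ k) ^ (e ℕ.∸ s))
  expand : ∀ e → e ℕ.< suc d → coeff p e * (+ k + + x) ^ e ≡ ∑ (suc d) (λ s → taylorTerm p k s e * X s)
  expand e e≤d = begin
    coeff p e * (+ k + + x) ^ e                        ≡⟨ cong (λ z → coeff p e * z ^ e) (ℤP.+-comm (+ k) (+ x)) ⟩
    coeff p e * (+ x + + k) ^ e                        ≡⟨ cong (coeff p e *_) (binomial-theorem e (+ x) (+ k)) ⟩
    coeff p e * ∑ (suc e) (binomial-term e)            ≡⟨ cong (coeff p e *_) (∑-extend (suc e) (suc d) (binomial-term e) e≤d vanish) ⟩
    coeff p e * ∑ (suc d) (binomial-term e)            ≡⟨ ∑-*ˡ (suc d) (coeff p e) (binomial-term e) ⟨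
    ∑ (suc d) (λ s → coeff p e * binomial-term e s)    ≡⟨ ∑-cong (suc d) (λ s _ → rearrange (coeff p e) (+ (e C s)) (X s) ((+ k) ^ (e ℕ.∸ s))) ⟩
    ∑ (suc d) (λ s → taylorTerm p k s e * X s)         ∎
    where
    vanish : ∀ s → suc e ℕ.≤ s → s ℕ.< suc d → binomial-term e s ≡ 0ℤ
    vanish s e<s _ = trans (cong (λ c → + c * (X s * (+ k) ^ (e ℕ.∸ s))) (k>n⇒nCk≡0 e<s)) (ℤP.*-zeroˡ (X s * (+ k) ^ (e ℕ.∸ s)))

eval≡taylorCoeff₀ : ∀ p k → eval p (+ k) ≡ taylorCoeff p k 0
eval≡taylorCoeff₀ p k = begin
  eval p (+ k)                                                             ≡⟨ cong (eval p) (ℤP.+-identityʳ (+ k)) ⟨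
  eval p (+ k + + 0)                                                       ≡⟨ eval-shift p k 0 ⟩
  taylorCoeff p k 0 * 1ℤ + ∑ (deg p) (λ r → taylorCoeff p k (suc r) * 0ℤ ^ suc r)
    ≡⟨ cong (_+_ (taylorCoeff p k 0 * 1ℤ)) (∑-zero (deg p) (λ r _ → trans (cong (taylorCoeff p k (suc r) *_) (ℤP.*-zeroˡ (0ℤ ^ r))) (ℤP.*-zeroʳ (taylorCoeff p k (suc r))))) ⟩
  taylorCoeff p k 0 * 1ℤ + 0ℤ                                              ≡⟨ trans (ℤP.+-identityʳ _) (ℤP.*-identityʳ _) ⟩
  taylorCoeff p k 0                                                        ∎
  where open ≡-Reasoning

m-taylor : ∀ p k x → m p (+ x) (+ k) ≡ ∑ (deg p) (λ r → taylorCoeff p k (suc r) * (+ x) ^ suc r)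
m-taylor p k x = begin
  eval p (+ k + + x) - eval p (+ k)                         ≡⟨ cong₂ _-_ (eval-shift p k x) (eval≡taylorCoeff₀ p k) ⟩
  (taylorCoeff p k 0 * 1ℤ + higher) - taylorCoeff p k 0     ≡⟨ cancel (taylorCoeff p k 0) higher ⟩
  higher                                                    ∎
  where
  open ≡-Reasoning
  higher : ℤ
  higher = ∑ (deg p) (λ r → taylorCoeff p k (suc r) * (+ x) ^ suc r)
  cancel : ∀ c h → (c * 1ℤ + h) - c ≡ h
  cancel = solve-∀

weight : Poly → ℕ
weight p = ∑ℕ (suc (deg p)) (λ e → ∣ coeff p e ∣ ℕ.* 2 ℕ.^ e)

∣taylorTerm∣ : ∀ p k s e → ∣ taylorTerm p k s e ∣ ≡ ∣ coeff p e ∣ ℕ.* ((e C s) ℕ.* k ℕ.^ (e ℕ.∸ s))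
∣taylorTerm∣ p k s e = trans (ℤP.abs-* (coeff p e) _) (cong (∣ coeff p e ∣ ℕ.*_)
  (trans (ℤP.abs-* (+ (e C s)) ((+ k) ^ (e ℕ.∸ s))) (cong ((e C s) ℕ.*_) (cong ∣_∣ (sym (pos-^ k (e ℕ.∸ s)))))))

∣taylorTerm∣≤ : ∀ p k s e {n} → 1 ℕ.≤ k → e ℕ.∸ s ℕ.≤ n → ∣ taylorTerm p k s e ∣ ℕ.≤ ∣ coeff p e ∣ ℕ.* 2 ℕ.^ e ℕ.* k ℕ.^ n
∣taylorTerm∣≤ p k s e {n} 1≤k e-s≤n = begin
  ∣ taylorTerm p k s e ∣                                ≡⟨ ∣taylorTerm∣ p k s e ⟩
  ∣ coeff p e ∣ ℕ.* ((e C s) ℕ.* k ℕ.^ (e ℕ.∸ s))        ≤⟨ ℕP.*-monoʳ-≤ ∣ coeff p e ∣ (ℕP.*-mono-≤ (nCk≤2^n e s) (^-monoʳ-≤ 1≤k e-s≤n)) ⟩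
  ∣ coeff p e ∣ ℕ.* (2 ℕ.^ e ℕ.* k ℕ.^ n)              ≡⟨ ℕP.*-assoc ∣ coeff p e ∣ (2 ℕ.^ e) _ ⟨
  ∣ coeff p e ∣ ℕ.* 2 ℕ.^ e ℕ.* k ℕ.^ n                ∎
  where open ℕP.≤-Reasoning

∣taylorCoeff∣≤ : ∀ p k s → 1 ℕ.≤ k → ∣ taylorCoeff p k s ∣ ℕ.≤ weight p ℕ.* k ℕ.^ (deg p ℕ.∸ s)
∣taylorCoeff∣≤ p k s 1≤k = begin
  ∣ taylorCoeff p k s ∣                                                  ≤⟨ ∣∑∣≤∑∣∣ (suc d) (taylorTerm p k s) ⟩
  ∑ℕ (suc d) (λ e → ∣ taylorTerm p k s e ∣)                              ≤⟨ ∑ℕ-mono-≤ (suc d) termwise ⟩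
  ∑ℕ (suc d) (λ e → ∣ coeff p e ∣ ℕ.* 2 ℕ.^ e ℕ.* k ℕ.^ (d ℕ.∸ s))      ≡⟨ ∑ℕ-*ʳ (suc d) (k ℕ.^ (d ℕ.∸ s)) (λ e → ∣ coeff p e ∣ ℕ.* 2 ℕ.^ e) ⟩
  weight p ℕ.* k ℕ.^ (d ℕ.∸ s)                                           ∎
  where
  open ℕP.≤-Reasoning
  d : ℕ
  d = deg p
  termwise : ∀ e → e ℕ.< suc d → ∣ taylorTerm p k s e ∣ ℕ.≤ ∣ coeff p e ∣ ℕ.* 2 ℕ.^ e ℕ.* k ℕ.^ (d ℕ.∸ s)
  termwise e (s≤s e≤d) = ∣taylorTerm∣≤ p k s e 1≤k (ℕP.∸-monoˡ-≤ s e≤d)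

-- Stated after multiplying by k, so that it also covers s = d, where the sum vanishes.
∣lowerTaylorTerms∣≤ : ∀ p k s → 1 ℕ.≤ k →
  ∣ ∑ (deg p) (taylorTerm p k s) ∣ ℕ.* k ℕ.≤ weight p ℕ.* k ℕ.^ (deg p ℕ.∸ s)
∣lowerTaylorTerms∣≤ p k s 1≤k = begin
  ∣ ∑ d (taylorTerm p k s) ∣ ℕ.* k                                       ≤⟨ ℕP.*-monoˡ-≤ k (∣∑∣≤∑∣∣ d (taylorTerm p k s)) ⟩
  ∑ℕ d (λ e → ∣ taylorTerm p k s e ∣) ℕ.* k                              ≡⟨ ∑ℕ-*ʳ d k (λ e → ∣ taylorTerm p k s e ∣) ⟨
  ∑ℕ d (λ e → ∣ taylorTerm p k s e ∣ ℕ.* k)                              ≤⟨ ∑ℕ-mono-≤ d termwise ⟩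
  ∑ℕ d (λ e → ∣ coeff p e ∣ ℕ.* 2 ℕ.^ e ℕ.* k ℕ.^ (d ℕ.∸ s))            ≡⟨ ∑ℕ-*ʳ d (k ℕ.^ (d ℕ.∸ s)) (λ e → ∣ coeff p e ∣ ℕ.* 2 ℕ.^ e) ⟩
  ∑ℕ d (λ e → ∣ coeff p e ∣ ℕ.* 2 ℕ.^ e) ℕ.* k ℕ.^ (d ℕ.∸ s)            ≤⟨ ℕP.*-monoˡ-≤ (k ℕ.^ (d ℕ.∸ s)) (∑ℕ≤∑ℕ-suc d (λ e → ∣ coeff p e ∣ ℕ.* 2 ℕ.^ e)) ⟩
  weight p ℕ.* k ℕ.^ (d ℕ.∸ s)                                           ∎
  where
  open ℕP.≤-Reasoning
  d : ℕ
  d = deg p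
  termwise : ∀ e → e ℕ.< d → ∣ taylorTerm p k s e ∣ ℕ.* k ℕ.≤ ∣ coeff p e ∣ ℕ.* 2 ℕ.^ e ℕ.* k ℕ.^ (d ℕ.∸ s)
  termwise e e<d with s ℕ.≤? e
  ... | yes s≤e = begin
    ∣ taylorTerm p k s e ∣ ℕ.* k                                  ≤⟨ ℕP.*-monoˡ-≤ k (∣taylorTerm∣≤ p k s e 1≤k ℕP.≤-refl) ⟩
    ∣ coeff p e ∣ ℕ.* 2 ℕ.^ e ℕ.* k ℕ.^ (e ℕ.∸ s) ℕ.* k         ≡⟨ ℕP.*-assoc (∣ coeff p e ∣ ℕ.* 2 ℕ.^ e) (k ℕ.^ (e ℕ.∸ s)) k ⟩
    ∣ coeff p e ∣ ℕ.* 2 ℕ.^ e ℕ.* (k ℕ.^ (e ℕ.∸ s) ℕ.* k)       ≡⟨ cong (∣ coeff p e ∣ ℕ.* 2 ℕ.^ e ℕ.*_) (trans (ℕP.*-comm _ k) (cong (k ℕ.^_) (sym (ℕP.+-∸-assoc 1 s≤e)))) ⟩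
    ∣ coeff p e ∣ ℕ.* 2 ℕ.^ e ℕ.* k ℕ.^ (suc e ℕ.∸ s)           ≤⟨ ℕP.*-monoʳ-≤ (∣ coeff p e ∣ ℕ.* 2 ℕ.^ e) (^-monoʳ-≤ 1≤k (ℕP.∸-monoˡ-≤ s e<d)) ⟩
    ∣ coeff p e ∣ ℕ.* 2 ℕ.^ e ℕ.* k ℕ.^ (d ℕ.∸ s)               ∎
  ... | no  s≰e = ℕP.≤-trans (ℕP.≤-reflexive vanishes) z≤n
    where
    vanishes : ∣ taylorTerm p k s e ∣ ℕ.* k ≡ 0
    vanishes = begin-equality
      ∣ taylorTerm p k s e ∣ ℕ.* k                              ≡⟨ cong (ℕ._* k) (∣taylorTerm∣ p k s e) ⟩
      ∣ coeff p e ∣ ℕ.* ((e C s) ℕ.* k ℕ.^ (e ℕ.∸ s)) ℕ.* k      ≡⟨ cong (λ c → ∣ coeff p e ∣ ℕ.* (c ℕ.* k ℕ.^ (e ℕ.∸ s)) ℕ.* k) (k>n⇒nCk≡0 (ℕP.≰⇒> s≰e)) ⟩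
      ∣ coeff p e ∣ ℕ.* 0 ℕ.* k                                 ≡⟨ cong (ℕ._* k) (ℕP.*-zeroʳ ∣ coeff p e ∣) ⟩
      0                                                         ∎

leadingTaylorTerm≥ : ∀ p k s → + 0 ℤ.< leading p → s ℕ.≤ deg p → + (k ℕ.^ (deg p ℕ.∸ s)) ℤ.≤ taylorTerm p k s (deg p)
leadingTaylorTerm≥ p k s 0<lead s≤d = begin
  + (k ℕ.^ (d ℕ.∸ s))                           ≤⟨ ℤ.+≤+ (ℕP.m≤n*m (k ℕ.^ (d ℕ.∸ s)) (d C s) {{ℕ.>-nonZero (1≤nCk d s s≤d)}}) ⟩
  + ((d C s) ℕ.* k ℕ.^ (d ℕ.∸ s))               ≤⟨ +n≤a*+n (leading p) _ 0<lead ⟩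
  leading p * + ((d C s) ℕ.* k ℕ.^ (d ℕ.∸ s))   ≡⟨ cong₂ _*_ (sym (coeff-deg p)) (trans (ℤP.pos-* (d C s) _) (cong (+ (d C s) *_) (pos-^ k (d ℕ.∸ s)))) ⟩
  taylorTerm p k s d                            ∎
  where
  open ℤP.≤-Reasoning
  d : ℕ
  d = deg p

taylorCoeff-large : ∀ p k s → + 0 ℤ.< leading p → s ℕ.≤ deg p → 1 ℕ.≤ k → 2 ℕ.* weight p ℕ.≤ k →
  taylorCoeff p k s ≡ + ∣ taylorCoeff p k s ∣ × k ℕ.^ (deg p ℕ.∸ s) ℕ.≤ 2 ℕ.* ∣ taylorCoeff p k s ∣
taylorCoeff-large p k s 0<lead s≤d 1≤k 2w≤k =
  subst (λ c → c ≡ + ∣ c ∣ × k ℕ.^ (d ℕ.∸ s) ℕ.≤ 2 ℕ.* ∣ c ∣) (sym (∑-last d (taylorTerm p k s)))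
        (dominated-sum lower (taylorTerm p k s d) (k ℕ.^ (d ℕ.∸ s)) ∣ lower ∣ (leadingTaylorTerm≥ p k s 0<lead s≤d) ℕP.≤-refl 2∣lower∣≤)
  where
  d : ℕ
  d = deg p
  lower : ℤ
  lower = ∑ d (taylorTerm p k s)
  2∣lower∣≤ : 2 ℕ.* ∣ lower ∣ ℕ.≤ k ℕ.^ (d ℕ.∸ s)
  2∣lower∣≤ = ℕP.*-cancelʳ-≤ _ _ k {{ℕ.>-nonZero 1≤k}} (begin
    2 ℕ.* ∣ lower ∣ ℕ.* k              ≡⟨ ℕP.*-assoc 2 ∣ lower ∣ k ⟩
    2 ℕ.* (∣ lower ∣ ℕ.* k)            ≤⟨ ℕP.*-monoʳ-≤ 2 (∣lowerTaylorTerms∣≤ p k s 1≤k) ⟩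
    2 ℕ.* (weight p ℕ.* k ℕ.^ (d ℕ.∸ s)) ≡⟨ ℕP.*-assoc 2 (weight p) _ ⟨
    2 ℕ.* weight p ℕ.* k ℕ.^ (d ℕ.∸ s)   ≤⟨ ℕP.*-monoˡ-≤ (k ℕ.^ (d ℕ.∸ s)) 2w≤k ⟩
    k ℕ.* k ℕ.^ (d ℕ.∸ s)              ≡⟨ ℕP.*-comm k _ ⟩
    k ℕ.^ (d ℕ.∸ s) ℕ.* k              ∎)
    where open ℕP.≤-Reasoning

-- Blocks: combinations of the m_{2^i}(k) that isolate one Taylor coefficient

block : Poly → ℕ → ℕ → ℕ → ℤ
block p k s j = ⟪ isolator s (deg p) , (λ e → m p (2^ℤ (j ℕ.+ e)) (+ k)) ⟫

2^-split : ∀ j e r → (2 ℕ.^ (j ℕ.+ e)) ℕ.^ r ≡ 2 ℕ.^ (j ℕ.* r) ℕ.* (2 ℕ.^ r) ℕ.^ e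
2^-split j e r = begin
  (2 ℕ.^ (j ℕ.+ e)) ℕ.^ r                ≡⟨ ℕP.^-*-assoc 2 (j ℕ.+ e) r ⟩
  2 ℕ.^ ((j ℕ.+ e) ℕ.* r)                ≡⟨ cong (2 ℕ.^_) (ℕP.*-distribʳ-+ r j e) ⟩
  2 ℕ.^ (j ℕ.* r ℕ.+ e ℕ.* r)            ≡⟨ ℕP.^-distribˡ-+-* 2 (j ℕ.* r) (e ℕ.* r) ⟩
  2 ℕ.^ (j ℕ.* r) ℕ.* 2 ℕ.^ (e ℕ.* r)    ≡⟨ cong (λ x → 2 ℕ.^ (j ℕ.* r) ℕ.* 2 ℕ.^ x) (ℕP.*-comm e r) ⟩
  2 ℕ.^ (j ℕ.* r) ℕ.* 2 ℕ.^ (r ℕ.* e)    ≡⟨ cong (2 ℕ.^ (j ℕ.* r) ℕ.*_) (ℕP.^-*-assoc 2 r e) ⟨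
  2 ℕ.^ (j ℕ.* r) ℕ.* (2 ℕ.^ r) ℕ.^ e    ∎
  where open ≡-Reasoning

2^ℤ-split : ∀ j e r → 2^ℤ (j ℕ.+ e) ^ r ≡ 2^ℤ (j ℕ.* r) * 2^ℤ r ^ e
2^ℤ-split j e r = begin
  2^ℤ (j ℕ.+ e) ^ r                           ≡⟨ pos-^ (2 ℕ.^ (j ℕ.+ e)) r ⟨
  + ((2 ℕ.^ (j ℕ.+ e)) ℕ.^ r)                 ≡⟨ cong +_ (2^-split j e r) ⟩
  + (2 ℕ.^ (j ℕ.* r) ℕ.* (2 ℕ.^ r) ℕ.^ e)     ≡⟨ ℤP.pos-* (2 ℕ.^ (j ℕ.* r)) _ ⟩
  2^ℤ (j ℕ.* r) * + ((2 ℕ.^ r) ℕ.^ e)         ≡⟨ cong (2^ℤ (j ℕ.* r) *_) (pos-^ (2 ℕ.^ r) e) ⟩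
  2^ℤ (j ℕ.* r) * 2^ℤ r ^ e                   ∎
  where open ≡-Reasoning

block-value : ∀ p k s j → 1 ℕ.≤ s → s ℕ.≤ deg p →
  block p k s j ≡ taylorCoeff p k s * (2^ℤ (j ℕ.* s) * + isolatorValue s (deg p))
block-value p k s@(suc s-1) j _ s≤d = begin
  ⟪ P , (λ e → m p (2^ℤ (j ℕ.+ e)) (+ k)) ⟫                            ≡⟨ ⟪⟫-cong P (λ e _ → trans (m-taylor p k _) (∑-cong d (λ r _ → split e r))) ⟩
  ⟪ P , (λ e → ∑ d (λ r → c (suc r) * (2^ℤ (j ℕ.* suc r) * 2^ℤ (suc r) ^ e))) ⟫
                                                                        ≡⟨ ⟪⟫-∑ P d (λ r e → c (suc r) * (2^ℤ (j ℕ.* suc r) * 2^ℤ (suc r) ^ e)) ⟩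
  ∑ d (λ r → ⟪ P , (λ e → c (suc r) * (2^ℤ (j ℕ.* suc r) * 2^ℤ (suc r) ^ e)) ⟫)
                                                                        ≡⟨ ∑-cong d (λ r _ → pull r) ⟩
  ∑ d (λ r → c (suc r) * (2^ℤ (j ℕ.* suc r) * evalᴸ P (2^ℤ (suc r))))  ≡⟨ ∑-single d s-1 s≤d others ⟩
  c s * (2^ℤ (j ℕ.* s) * evalᴸ P (2^ℤ s))                              ≡⟨ cong (λ v → c s * (2^ℤ (j ℕ.* s) * v)) (isolator-value s d) ⟩
  c s * (2^ℤ (j ℕ.* s) * + isolatorValue s d)                          ∎
  where
  open ≡-Reasoning
  d : ℕ
  d = deg p
  P : List ℤ
  P = isolator s d
  c : ℕ → ℤ
  c = taylorCoeff p k
  split : ∀ e r → c (suc r) * 2^ℤ (j ℕ.+ e) ^ suc r ≡ c (suc r) * (2^ℤ (j ℕ.* suc r) * 2^ℤ (suc r) ^ e)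
  split e r = cong (c (suc r) *_) (2^ℤ-split j e (suc r))
  pull : ∀ r → ⟪ P , (λ e → c (suc r) * (2^ℤ (j ℕ.* suc r) * 2^ℤ (suc r) ^ e)) ⟫ ≡ c (suc r) * (2^ℤ (j ℕ.* suc r) * evalᴸ P (2^ℤ (suc r)))
  pull r = trans (⟪⟫-*ˡ P (c (suc r)) _) (cong (c (suc r) *_) (⟪⟫-*ˡ P (2^ℤ (j ℕ.* suc r)) (2^ℤ (suc r) ^_)))
  others : ∀ r → r ℕ.< d → r ≢ s-1 → c (suc r) * (2^ℤ (j ℕ.* suc r) * evalᴸ P (2^ℤ (suc r))) ≡ 0ℤ
  others r r<d r≢s-1 = begin
    c (suc r) * (2^ℤ (j ℕ.* suc r) * evalᴸ P (2^ℤ (suc r))) ≡⟨ cong (λ v → c (suc r) * (2^ℤ (j ℕ.* suc r) * v)) (isolator-root s d (suc r) (s≤s z≤n) r<d r+1≢s) ⟩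
    c (suc r) * (2^ℤ (j ℕ.* suc r) * 0ℤ)                   ≡⟨ cong (c (suc r) *_) (ℤP.*-zeroʳ (2^ℤ (j ℕ.* suc r))) ⟩
    c (suc r) * 0ℤ                                         ≡⟨ ℤP.*-zeroʳ (c (suc r)) ⟩
    0ℤ                                                     ∎
    where
    r+1≢s : suc r ≢ s
    r+1≢s refl = r≢s-1 refl

-- A lower bound for k₀ − k

∣m∣≤ : ∀ p k x → 1 ℕ.≤ k → x ℕ.≤ k → ∣ m p (+ x) (+ k) ∣ ℕ.≤ deg p ℕ.* (weight p ℕ.* x ℕ.* k ℕ.^ (deg p ℕ.∸ 1))
∣m∣≤ p k x 1≤k x≤k = begin
  ∣ m p (+ x) (+ k) ∣                                         ≡⟨ cong ∣_∣ (m-taylor p k x) ⟩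
  ∣ ∑ d (λ r → c (suc r) * (+ x) ^ suc r) ∣                   ≤⟨ ∣∑∣≤∑∣∣ d (λ r → c (suc r) * (+ x) ^ suc r) ⟩
  ∑ℕ d (λ r → ∣ c (suc r) * (+ x) ^ suc r ∣)                  ≤⟨ ∑ℕ-mono-≤ d termwise ⟩
  ∑ℕ d (λ _ → weight p ℕ.* x ℕ.* k ℕ.^ (d ℕ.∸ 1))             ≡⟨ ∑ℕ-const d _ ⟩
  d ℕ.* (weight p ℕ.* x ℕ.* k ℕ.^ (d ℕ.∸ 1))                  ∎
  where
  open ℕP.≤-Reasoning
  d : ℕ
  d = deg p
  c : ℕ → ℤ
  c = taylorCoeff p k
  reorder : ∀ w a x b → w ℕ.* a ℕ.* (x ℕ.* b) ≡ w ℕ.* x ℕ.* (a ℕ.* b)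
  reorder = ℕSolver.solve-∀
  termwise : ∀ r → r ℕ.< d → ∣ c (suc r) * (+ x) ^ suc r ∣ ℕ.≤ weight p ℕ.* x ℕ.* k ℕ.^ (d ℕ.∸ 1)
  termwise r r<d = begin
    ∣ c (suc r) * (+ x) ^ suc r ∣                                   ≡⟨ trans (ℤP.abs-* (c (suc r)) _) (cong (∣ c (suc r) ∣ ℕ.*_) (cong ∣_∣ (sym (pos-^ x (suc r))))) ⟩
    ∣ c (suc r) ∣ ℕ.* (x ℕ.* x ℕ.^ r)                               ≤⟨ ℕP.*-mono-≤ (∣taylorCoeff∣≤ p k (suc r) 1≤k) (ℕP.*-monoʳ-≤ x (ℕP.^-monoˡ-≤ r x≤k)) ⟩
    weight p ℕ.* k ℕ.^ (d ℕ.∸ suc r) ℕ.* (x ℕ.* k ℕ.^ r)            ≡⟨ reorder (weight p) (k ℕ.^ (d ℕ.∸ suc r)) x (k ℕ.^ r) ⟩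
    weight p ℕ.* x ℕ.* (k ℕ.^ (d ℕ.∸ suc r) ℕ.* k ℕ.^ r)            ≡⟨ cong (weight p ℕ.* x ℕ.*_) (trans (sym (ℕP.^-distribˡ-+-* k (d ℕ.∸ suc r) r)) (cong (k ℕ.^_) ([d∸[1+r]]+r≡d∸1 r<d))) ⟩
    weight p ℕ.* x ℕ.* k ℕ.^ (d ℕ.∸ 1)                              ∎

K0Cond-if-small-increments : ∀ p k N → m p (+ N) (+ k) + + 4 * m p (+ 1) (+ k) ℤ.< eval p (+ k) → K0Cond p (+ k) (+ k + + N)
K0Cond-if-small-increments p k N small =
  subst₂ ℤ._<_ (cancel a E m₁) (double E m₁) (ℤP.+-monoˡ-< (E - + 4 * m₁) small)
  where
  a : ℤ
  a = eval p (+ k + + N)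
  E : ℤ
  E = eval p (+ k)
  m₁ : ℤ
  m₁ = m p (+ 1) (+ k)
  cancel : ∀ a E m₁ → ((a - E) + + 4 * m₁) + (E - + 4 * m₁) ≡ a
  cancel = solve-∀
  double : ∀ E m₁ → E + (E - + 4 * m₁) ≡ + 2 * E - + 4 * m₁
  double = solve-∀

K0Cond-near : ∀ p k N → + 0 ℤ.< leading p → 1 ℕ.≤ deg p → 2 ℕ.* weight p ℕ.≤ k →
  suc (2 ℕ.* deg p ℕ.* weight p) ℕ.* (N ℕ.+ 4) ℕ.≤ k → K0Cond p (+ k) (+ k + + N)
K0Cond-near p k N 0<lead 1≤d 2w≤k near = K0Cond-if-small-increments p k N (begin-strict
  mN + + 4 * m₁                 ≤⟨ ℤP.+-mono-≤ (i≤+∣i∣ mN) (ℤP.*-monoˡ-≤-nonNeg (+ 4) (i≤+∣i∣ m₁)) ⟩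
  + ∣ mN ∣ + + 4 * + ∣ m₁ ∣     ≡⟨ cong (_+_ (+ ∣ mN ∣)) (ℤP.pos-* 4 ∣ m₁ ∣) ⟨
  + (∣ mN ∣ ℕ.+ 4 ℕ.* ∣ m₁ ∣)   <⟨ ℤ.+<+ (ℕP.*-cancelˡ-< 2 _ _ twice-small) ⟩
  + ∣ E ∣                       ≡⟨ trans (sym (proj₁ E-large)) (sym (eval≡taylorCoeff₀ p k)) ⟩
  eval p (+ k)                  ∎)
  where
  open ℤP.≤-Reasoning
  d : ℕ
  d = deg p
  w : ℕ
  w = weight p
  K : ℕ
  K = k ℕ.^ (d ℕ.∸ 1)
  mN : ℤ
  mN = m p (+ N) (+ k)
  m₁ : ℤ
  m₁ = m p (+ 1) (+ k)
  E : ℤ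
  E = taylorCoeff p k 0
  N+4≤k : N ℕ.+ 4 ℕ.≤ k
  N+4≤k = ℕP.≤-trans (ℕP.m≤n*m (N ℕ.+ 4) (suc (2 ℕ.* d ℕ.* w))) near
  1≤k : 1 ℕ.≤ k
  1≤k = ℕP.≤-trans (s≤s z≤n) (ℕP.≤-trans (ℕP.m≤n+m 4 N) N+4≤k)
  E-large : taylorCoeff p k 0 ≡ + ∣ taylorCoeff p k 0 ∣ × k ℕ.^ (deg p ℕ.∸ 0) ℕ.≤ 2 ℕ.* ∣ taylorCoeff p k 0 ∣
  E-large = taylorCoeff-large p k 0 0<lead z≤n 1≤k 2w≤k
  collect : ∀ d w N K → 2 ℕ.* (d ℕ.* (w ℕ.* N ℕ.* K) ℕ.+ 4 ℕ.* (d ℕ.* (w ℕ.* 1 ℕ.* K))) ≡ 2 ℕ.* d ℕ.* w ℕ.* (N ℕ.+ 4) ℕ.* K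
  collect = ℕSolver.solve-∀
  twice-small : 2 ℕ.* (∣ mN ∣ ℕ.+ 4 ℕ.* ∣ m₁ ∣) ℕ.< 2 ℕ.* ∣ E ∣
  twice-small = ℕP.≤-<-trans (ℕP.*-monoʳ-≤ 2 (ℕP.+-mono-≤ (∣m∣≤ p k N 1≤k (ℕP.≤-trans (ℕP.m≤m+n N 4) N+4≤k)) (ℕP.*-monoʳ-≤ 4 (∣m∣≤ p k 1 1≤k 1≤k))))
    (ℕP.≤-<-trans (ℕP.≤-reflexive (collect d w N K)) (ℕP.<-≤-trans (ℕP.*-monoˡ-< K {{ℕ.>-nonZero (1≤^ 1≤k (d ℕ.∸ 1))}} small-factor)
      (ℕP.≤-trans (ℕP.≤-reflexive k*K≡k^d) (proj₂ E-large))))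
    where
    small-factor : 2 ℕ.* d ℕ.* w ℕ.* (N ℕ.+ 4) ℕ.< k
    small-factor = ℕP.<-≤-trans (ℕP.m<n+m (2 ℕ.* d ℕ.* w ℕ.* (N ℕ.+ 4)) (ℕP.≤-trans (s≤s z≤n) (ℕP.m≤n+m 4 N))) near
    k*K≡k^d : k ℕ.* K ≡ k ℕ.^ (d ℕ.∸ 0)
    k*K≡k^d = cong (k ℕ.^_) (ℕP.m+[n∸m]≡n 1≤d)

k₀-maximal : ∀ {p k n N} → IsK0 p (+ k) (+ k + + n) → K0Cond p (+ k) (+ k + + N) → N ℕ.≤ n
k₀-maximal {k = k} {n = n} {N = N} (_ , maximal) cond with N ℕ.≤? n
... | yes N≤n = N≤n
... | no  N≰n = ⊥-elim (maximal (+ k + + N) (ℤP.+-monoʳ-< (+ k) (ℤ.+<+ (ℕP.≰⇒> N≰n))) cond)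

-- Spreading coefficients over the indices of a linear combination

spread : ℕ → ℕ → (ℕ → List ℤ) → (ℕ → ℕ → ℤ) → (ℕ → ℕ → ℕ) → ℕ → ℤ
spread d J P c h y = ∑ d (λ i → ⟪ P i , (λ e → ∑ J (λ j → c i j * kronecker (h j e) y)) ⟫)

∑-spread : ∀ d J Y P c h (G : ℕ → ℤ) → (∀ i j e → i ℕ.< d → j ℕ.< J → e ℕ.< length (P i) → h j e ℕ.< Y) →
  ∑ Y (λ y → spread d J P c h y * G y) ≡ ∑ d (λ i → ∑ J (λ j → c i j * ⟪ P i , (λ e → G (h j e)) ⟫))
∑-spread d J Y P c h G h<Y = begin
  ∑ Y (λ y → spread d J P c h y * G y)
    ≡⟨ ∑-cong Y (λ y _ → push y) ⟩
  ∑ Y (λ y → ∑ d (λ i → ⟪ P i , (λ e → ∑ J (λ j → term i j e y)) ⟫))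
    ≡⟨ ∑-comm Y d (λ y i → ⟪ P i , (λ e → ∑ J (λ j → term i j e y)) ⟫) ⟩
  ∑ d (λ i → ∑ Y (λ y → ⟪ P i , (λ e → ∑ J (λ j → term i j e y)) ⟫))
    ≡⟨ ∑-cong d (λ i _ → sym (⟪⟫-∑ (P i) Y (λ y e → ∑ J (λ j → term i j e y)))) ⟩
  ∑ d (λ i → ⟪ P i , (λ e → ∑ Y (λ y → ∑ J (λ j → term i j e y))) ⟫)
    ≡⟨ ∑-cong d (λ i i<d → ⟪⟫-cong (P i) (λ e e<l → trans (∑-comm Y J (λ y j → term i j e y)) (∑-cong J (λ j j<J → pick i j e (h<Y i j e i<d j<J e<l))))) ⟩
  ∑ d (λ i → ⟪ P i , (λ e → ∑ J (λ j → c i j * G (h j e))) ⟫)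
    ≡⟨ ∑-cong d (λ i _ → trans (⟪⟫-∑ (P i) J (λ j e → c i j * G (h j e))) (∑-cong J (λ j _ → ⟪⟫-*ˡ (P i) (c i j) (λ e → G (h j e))))) ⟩
  ∑ d (λ i → ∑ J (λ j → c i j * ⟪ P i , (λ e → G (h j e)) ⟫)) ∎
  where
  open ≡-Reasoning
  term : ℕ → ℕ → ℕ → ℕ → ℤ
  term i j e y = c i j * (kronecker (h j e) y * G y)
  push : ∀ y → spread d J P c h y * G y ≡ ∑ d (λ i → ⟪ P i , (λ e → ∑ J (λ j → term i j e y)) ⟫)
  push y = trans (sym (∑-*ʳ d (G y) _)) (∑-cong d (λ i _ → trans (sym (⟪⟫-*ʳ (P i) (G y) _))
             (⟪⟫-cong (P i) (λ e _ → trans (sym (∑-*ʳ J (G y) _)) (∑-cong J (λ j _ → ℤP.*-assoc (c i j) _ (G y)))))))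
  pick : ∀ i j e → h j e ℕ.< Y → ∑ Y (λ y → term i j e y) ≡ c i j * G (h j e)
  pick i j e h<Y = trans (∑-*ˡ Y (c i j) _) (cong (c i j *_) (∑-kronecker Y (h j e) G h<Y))

∣spread∣≤ : ∀ d J P c h y {M} → (∀ e i j → h i e ≡ h j e → i ≡ j) → (∀ i j → ∣ c i j ∣ ℕ.≤ M) →
  ∣ spread d J P c h y ∣ ℕ.≤ ∑ℕ d (λ i → ∑∣∣ᴸ (P i)) ℕ.* M
∣spread∣≤ d J P c h y {M} h-inj c≤M = begin
  ∣ spread d J P c h y ∣                                           ≤⟨ ∣∑∣≤∑∣∣ d _ ⟩
  ∑ℕ d (λ i → ∣ ⟪ P i , (λ e → ∑ J (λ j → c i j * kronecker (h j e) y)) ⟫ ∣)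
                                                                   ≤⟨ ∑ℕ-mono-≤ d (λ i _ → ∣⟪⟫∣≤ (P i) _ (λ e → ∣∑-kronecker∣≤ J (c i) (λ j → h j e) y (h-inj e) (λ j _ → c≤M i j))) ⟩
  ∑ℕ d (λ i → ∑∣∣ᴸ (P i) ℕ.* M)                                    ≡⟨ ∑ℕ-*ʳ d M (λ i → ∑∣∣ᴸ (P i)) ⟩
  ∑ℕ d (λ i → ∑∣∣ᴸ (P i)) ℕ.* M                                    ∎
  where open ℕP.≤-Reasoning

module Construction (p : Poly) (2≤d : 2 ℕ.≤ deg p) (0<lead : + 0 ℤ.< leading p) where

  d : ℕ
  d = deg p

  w : ℕ
  w = weight p

  -- Row i of the expansion uses the Taylor coefficient of order d − i, of size about kⁱ.
  level : ℕ → ℕ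
  level i = d ℕ.∸ i

  P : ℕ → List ℤ
  P i = isolator (level i) d

  D : ℕ → ℕ
  D i = isolatorValue (level i) d

  Λ : ℕ
  Λ = ∑ℕ d (λ i → length (P i))

  ρ : ℕ
  ρ = 2 ℕ.^ d ℕ.+ 2 ℕ.* ∑ℕ d D ℕ.* w ℕ.* 2 ℕ.^ d
  B : ℕ
  B = ∑ℕ d (λ i → ∑∣∣ᴸ (P i))

  M : ℕ
  M = 5 ℕ.* suc (2 ℕ.* d ℕ.* w)

  q₀ : ℕ
  q₀ = Λ

  ℓ₀ : ℕ
  ℓ₀ = ρ ℕ.* B ℕ.+ ρ

  K : ℕ → ℕ
  K q = 2 ℕ.+ 2 ℕ.* w ℕ.+ (2 ℕ.* q ℕ.+ 1) ℕ.* (2 ℕ.* q ℕ.+ 1) ℕ.+ M ℕ.* M ℕ.* 4^ (suc Λ)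

  K-bounds : ∀ {q k} → K q ℕ.≤ k →
    2 ℕ.≤ k × 2 ℕ.* w ℕ.≤ k × (2 ℕ.* q ℕ.+ 1) ℕ.* (2 ℕ.* q ℕ.+ 1) ℕ.≤ k × M ℕ.* M ℕ.* 4^ (suc Λ) ℕ.≤ k
  K-bounds {q} K≤k =
    let first₃ , M²4^Λ+1≤k = +≤⇒≤×≤ {2 ℕ.+ 2 ℕ.* w ℕ.+ (2 ℕ.* q ℕ.+ 1) ℕ.* (2 ℕ.* q ℕ.+ 1)} K≤k
        first₂ , [2q+1]²≤k = +≤⇒≤×≤ {2 ℕ.+ 2 ℕ.* w} first₃
        2≤k    , 2w≤k      = +≤⇒≤×≤ {2} first₂
    in 2≤k , 2w≤k , [2q+1]²≤k , M²4^Λ+1≤k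

  module Instance (q : ℕ) (q₀≤q : q₀ ℕ.≤ q) (ℓ : ℕ) (ℓ₀≤ℓ : ℓ₀ ℕ.≤ ℓ) (k : ℕ) (K≤k : K q ℕ.≤ k)
                  (n : ℕ) (isK0 : IsK0 p (+ k) (+ k + + n)) (Q : ℕ) (Q≤ : Q ℕ.≤ q ℕ.* k ℕ.^ (d ℕ.∸ 1)) where

    2≤k : 2 ℕ.≤ k
    2≤k = proj₁ (K-bounds {q} K≤k)
    2w≤k : 2 ℕ.* w ℕ.≤ k
    2w≤k = proj₁ (proj₂ (K-bounds {q} K≤k))
    [2q+1]²≤k : (2 ℕ.* q ℕ.+ 1) ℕ.* (2 ℕ.* q ℕ.+ 1) ℕ.≤ k
    [2q+1]²≤k = proj₁ (proj₂ (proj₂ (K-bounds {q} K≤k)))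
    M²4^Λ+1≤k : M ℕ.* M ℕ.* 4^ (suc Λ) ℕ.≤ k
    M²4^Λ+1≤k = proj₂ (proj₂ (proj₂ (K-bounds {q} K≤k)))
    1≤k : 1 ℕ.≤ k
    1≤k = ℕP.≤-trans (s≤s z≤n) 2≤k

    J-1 : ℕ
    J-1 = proj₁ (4^suc-between k 2≤k)
    J : ℕ
    J = suc J-1
    k≤4^J : k ℕ.≤ 4^ J
    k≤4^J = proj₁ (proj₂ (4^suc-between k 2≤k))
    4^J≤4k : 4^ J ℕ.≤ 4 ℕ.* k
    4^J≤4k = proj₂ (proj₂ (4^suc-between k 2≤k))

    d-1 : ℕ
    d-1 = d ℕ.∸ 1
    d≡1+d-1 : d ≡ suc d-1
    d≡1+d-1 = sym (ℕP.m+[n∸m]≡n (ℕP.≤-trans (s≤s z≤n) 2≤d))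

    level≤d : ∀ i → level i ℕ.≤ d
    level≤d i = ℕP.m∸n≤m d i

    d∸level : ∀ {i} → i ℕ.≤ d → d ℕ.∸ level i ≡ i
    d∸level = ℕP.m∸[m∸n]≡n

    c : ℕ → ℤ
    c i = taylorCoeff p k (level i)

    c≡+∣c∣ : ∀ i → c i ≡ + ∣ c i ∣
    c≡+∣c∣ i = proj₁ (taylorCoeff-large p k (level i) 0<lead (level≤d i) 1≤k 2w≤k)

    k^i≤2∣c∣ : ∀ {i} → i ℕ.≤ d → k ℕ.^ i ℕ.≤ 2 ℕ.* ∣ c i ∣
    k^i≤2∣c∣ {i} i≤d = subst (λ e → k ℕ.^ e ℕ.≤ 2 ℕ.* ∣ c i ∣) (d∸level i≤d)
                             (proj₂ (taylorCoeff-large p k (level i) 0<lead (level≤d i) 1≤k 2w≤k))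

    ∣c∣≤wk^i : ∀ {i} → i ℕ.≤ d → ∣ c i ∣ ℕ.≤ w ℕ.* k ℕ.^ i
    ∣c∣≤wk^i {i} i≤d = subst (λ e → ∣ c i ∣ ℕ.≤ w ℕ.* k ℕ.^ e) (d∸level i≤d) (∣taylorCoeff∣≤ p k (level i) 1≤k)

    1≤∣c∣ : ∀ {i} → i ℕ.≤ d → 1 ℕ.≤ ∣ c i ∣
    1≤∣c∣ {i} i≤d with ∣ c i ∣ | k^i≤2∣c∣ i≤d
    ... | zero  | k^i≤0 = ⊥-elim (ℕP.<⇒≱ (1≤^ 1≤k i) k^i≤0)
    ... | suc _ | _     = s≤s z≤n

    scale : ℕ → ℕ → ℕ
    scale i j = D i ℕ.* ∣ c i ∣ ℕ.* 2 ℕ.^ (suc j ℕ.* level i)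

    1≤scale : ∀ i j → i ℕ.≤ d-1 → j ℕ.≤ J-1 → 1 ℕ.≤ scale i j
    1≤scale i j i≤d-1 _ = ℕP.*-mono-≤ (ℕP.*-mono-≤ (1≤isolatorValue (level i) d) (1≤∣c∣ (ℕP.≤-trans i≤d-1 (ℕP.m∸n≤m d 1))))
                                      (1≤2^ (suc j ℕ.* level i))

    scale-step : ∀ i j → i ℕ.≤ d-1 → j ℕ.< J-1 → scale i (suc j) ℕ.≤ ρ ℕ.* scale i j
    scale-step i j _ _ = begin
      scale i (suc j)
        ≡⟨ cong (D i ℕ.* ∣ c i ∣ ℕ.*_) (ℕP.^-distribˡ-+-* 2 (level i) (suc j ℕ.* level i)) ⟩
      D i ℕ.* ∣ c i ∣ ℕ.* (2 ℕ.^ level i ℕ.* 2 ℕ.^ (suc j ℕ.* level i))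
        ≡⟨ reorder (D i) ∣ c i ∣ (2 ℕ.^ level i) _ ⟩
      2 ℕ.^ level i ℕ.* scale i j
        ≤⟨ ℕP.*-monoˡ-≤ (scale i j) (ℕP.≤-trans (ℕP.^-monoʳ-≤ 2 (level≤d i)) (ℕP.m≤m+n (2 ℕ.^ d) _)) ⟩
      ρ ℕ.* scale i j ∎
      where
      open ℕP.≤-Reasoning
      reorder : ∀ a b x y → a ℕ.* b ℕ.* (x ℕ.* y) ≡ x ℕ.* (a ℕ.* b ℕ.* y)
      reorder = ℕSolver.solve-∀

    scale-next-row : ∀ i → i ℕ.< d-1 → scale (suc i) 0 ℕ.≤ ρ ℕ.* scale i J-1
    scale-next-row i i<d-1 = ℕP.*-cancelˡ-≤ 2 (begin
      2 ℕ.* scale (suc i) 0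
        ≤⟨ ℕP.*-monoʳ-≤ 2 (ℕP.*-mono-≤ (ℕP.*-mono-≤ (term≤∑ℕ d D (suc i) i+1<d) (∣c∣≤wk^i (ℕP.<⇒≤ i+1<d)))
                                       (ℕP.^-monoʳ-≤ 2 (ℕP.≤-trans (ℕP.≤-reflexive (ℕP.*-identityˡ (level (suc i)))) (level≤d (suc i))))) ⟩
      2 ℕ.* (∑ℕ d D ℕ.* (w ℕ.* k ℕ.^ suc i) ℕ.* 2 ℕ.^ d)
        ≡⟨ reorder₁ (∑ℕ d D) w (k ℕ.^ suc i) (2 ℕ.^ d) ⟩
      (2 ℕ.* ∑ℕ d D ℕ.* w ℕ.* 2 ℕ.^ d) ℕ.* (k ℕ.* k ℕ.^ i)
        ≤⟨ ℕP.*-mono-≤ (ℕP.m≤n+m _ (2 ℕ.^ d)) (ℕP.*-mono-≤ (ℕP.≤-trans k≤4^J 4^J≤2^JL) (k^i≤2∣c∣ (ℕP.≤-trans (ℕP.n≤1+n i) (ℕP.<⇒≤ i+1<d)))) ⟩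
      ρ ℕ.* (2 ℕ.^ (J ℕ.* level i) ℕ.* (2 ℕ.* ∣ c i ∣))
        ≤⟨ ℕP.*-monoʳ-≤ ρ (ℕP.≤-trans (ℕP.≤-reflexive (reorder₂ (2 ℕ.^ (J ℕ.* level i)) ∣ c i ∣))
                                      (ℕP.*-monoʳ-≤ 2 (ℕP.*-monoˡ-≤ (2 ℕ.^ (J ℕ.* level i)) (ℕP.*-monoˡ-≤ ∣ c i ∣ (1≤isolatorValue (level i) d))))) ⟩
      ρ ℕ.* (2 ℕ.* scale i J-1)
        ≡⟨ reorder₃ ρ (scale i J-1) ⟩
      2 ℕ.* (ρ ℕ.* scale i J-1) ∎)
      where
      open ℕP.≤-Reasoning
      i+1<d : suc i ℕ.< d
      i+1<d = ℕP.<-≤-trans (s≤s i<d-1) (ℕP.≤-reflexive (sym d≡1+d-1))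
      4^J≤2^JL : 4^ J ℕ.≤ 2 ℕ.^ (J ℕ.* level i)
      4^J≤2^JL = ℕP.^-monoʳ-≤ 2 (ℕP.≤-trans (ℕP.≤-reflexive (ℕP.*-comm 2 J)) (ℕP.*-monoʳ-≤ J (ℕP.m+n≤o⇒m≤o∸n 2 i+1<d)))
      reorder₁ : ∀ a b x e → 2 ℕ.* (a ℕ.* (b ℕ.* x) ℕ.* e) ≡ (2 ℕ.* a ℕ.* b ℕ.* e) ℕ.* x
      reorder₁ = ℕSolver.solve-∀
      reorder₂ : ∀ t x → t ℕ.* (2 ℕ.* x) ≡ 2 ℕ.* (1 ℕ.* x ℕ.* t)
      reorder₂ = ℕSolver.solve-∀
      reorder₃ : ∀ r x → r ℕ.* (2 ℕ.* x) ≡ 2 ℕ.* (r ℕ.* x)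
      reorder₃ = ℕSolver.solve-∀

    2q+1≤2^J : 2 ℕ.* q ℕ.+ 1 ℕ.≤ 2 ℕ.^ J
    2q+1≤2^J = square-cancel-≤ _ _ (ℕP.≤-trans [2q+1]²≤k (ℕP.≤-trans k≤4^J (ℕP.≤-reflexive (4^≡2^*2^ J))))

    1≤ρ : 1 ℕ.≤ ρ
    1≤ρ = ℕP.≤-trans (1≤2^ d) (ℕP.m≤m+n (2 ℕ.^ d) _)

    Q<ρ*scale : Q ℕ.< ρ ℕ.* scale d-1 J-1
    Q<ρ*scale = ℕP.<-≤-trans (ℕP.*-cancelˡ-< 2 Q _ twice) (begin
      ∣ c d-1 ∣ ℕ.* 2 ℕ.^ J                        ≤⟨ ℕP.*-monoˡ-≤ (2 ℕ.^ J) (ℕP.m≤n*m ∣ c d-1 ∣ (D d-1) {{ℕ.>-nonZero (1≤isolatorValue (level d-1) d)}}) ⟩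
      D d-1 ℕ.* ∣ c d-1 ∣ ℕ.* 2 ℕ.^ J              ≡⟨ cong (λ e → D d-1 ℕ.* ∣ c d-1 ∣ ℕ.* 2 ℕ.^ e) (sym (trans (cong (J ℕ.*_) level-d-1≡1) (ℕP.*-identityʳ J))) ⟩
      scale d-1 J-1                                ≤⟨ ℕP.m≤n*m (scale d-1 J-1) ρ {{ℕ.>-nonZero 1≤ρ}} ⟩
      ρ ℕ.* scale d-1 J-1                          ∎)
      where
      open ℕP.≤-Reasoning
      level-d-1≡1 : level d-1 ≡ 1
      level-d-1≡1 = d∸level {1} (ℕP.≤-trans (s≤s z≤n) 2≤d)
      reorder : ∀ q x → 2 ℕ.* (q ℕ.* x) ℕ.+ x ≡ (2 ℕ.* q ℕ.+ 1) ℕ.* x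
      reorder = ℕSolver.solve-∀
      reorder′ : ∀ t x → t ℕ.* (2 ℕ.* x) ≡ 2 ℕ.* (x ℕ.* t)
      reorder′ = ℕSolver.solve-∀
      twice : 2 ℕ.* Q ℕ.< 2 ℕ.* (∣ c d-1 ∣ ℕ.* 2 ℕ.^ J)
      twice = begin-strict
        2 ℕ.* Q                                   ≤⟨ ℕP.*-monoʳ-≤ 2 Q≤ ⟩
        2 ℕ.* (q ℕ.* k ℕ.^ d-1)                   <⟨ ℕP.m<m+n _ (1≤^ 1≤k d-1) ⟩
        2 ℕ.* (q ℕ.* k ℕ.^ d-1) ℕ.+ k ℕ.^ d-1     ≡⟨ reorder q (k ℕ.^ d-1) ⟩
        (2 ℕ.* q ℕ.+ 1) ℕ.* k ℕ.^ d-1             ≤⟨ ℕP.*-mono-≤ 2q+1≤2^J (k^i≤2∣c∣ (ℕP.m∸n≤m d 1)) ⟩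
        2 ℕ.^ J ℕ.* (2 ℕ.* ∣ c d-1 ∣)             ≡⟨ reorder′ (2 ℕ.^ J) ∣ c d-1 ∣ ⟩
        2 ℕ.* (∣ c d-1 ∣ ℕ.* 2 ℕ.^ J)             ∎

    expansion : Σ[ δ ∈ (ℕ → ℕ → ℕ) ] Σ[ r ∈ ℕ ]
      (Q ≡ ∑ℕ (suc d-1) (λ i → ∑ℕ J (λ j → δ i j ℕ.* scale i j)) ℕ.+ r) × r ℕ.< scale 0 0 × (∀ i j → δ i j ℕ.≤ ρ)
    expansion = greedy-expansion² d-1 J-1 scale ρ Q 1≤scale scale-step scale-next-row Q<ρ*scale

    δ : ℕ → ℕ → ℕ
    δ = proj₁ expansion

    r : ℕ
    r = proj₁ (proj₂ expansion)

    X : ℕ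
    X = ∑ℕ d (λ i → ∑ℕ J (λ j → δ i j ℕ.* scale i j))

    Q≡X+r : Q ≡ X ℕ.+ r
    Q≡X+r = subst (λ e → Q ≡ ∑ℕ e (λ i → ∑ℕ J (λ j → δ i j ℕ.* scale i j)) ℕ.+ r) (sym d≡1+d-1) (proj₁ (proj₂ (proj₂ expansion)))

    δ≤ρ : ∀ i j → δ i j ℕ.≤ ρ
    δ≤ρ = proj₂ (proj₂ (proj₂ (proj₂ expansion)))

    ρ≤ℓ : ρ ℕ.≤ ℓ
    ρ≤ℓ = ℕP.≤-trans (ℕP.m≤n+m ρ (ρ ℕ.* B)) ℓ₀≤ℓ

    r≤ℓ : r ℕ.≤ ℓ
    r≤ℓ = ℕP.≤-trans (ℕP.<⇒≤ (proj₁ (proj₂ (proj₂ (proj₂ expansion))))) (ℕP.≤-trans scale₀₀≤ρ ρ≤ℓ)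
      where
      0<d : 0 ℕ.< d
      0<d = ℕP.≤-trans (s≤s z≤n) 2≤d
      ∑Dw2^d≤ρ : ∑ℕ d D ℕ.* w ℕ.* 2 ℕ.^ d ℕ.≤ ρ
      ∑Dw2^d≤ρ = ℕP.≤-trans (ℕP.m≤n*m _ 2) (ℕP.≤-trans (ℕP.≤-reflexive (reorder (∑ℕ d D) w (2 ℕ.^ d))) (ℕP.m≤n+m _ (2 ℕ.^ d)))
        where
        reorder : ∀ a b x → 2 ℕ.* (a ℕ.* b ℕ.* x) ≡ 2 ℕ.* a ℕ.* b ℕ.* x
        reorder = ℕSolver.solve-∀
      scale₀₀≤ρ : scale 0 0 ℕ.≤ ρ
      scale₀₀≤ρ = ℕP.≤-trans (ℕP.*-mono-≤ (ℕP.*-mono-≤ (term≤∑ℕ d D 0 0<d) (ℕP.≤-trans (∣c∣≤wk^i z≤n) (ℕP.≤-reflexive (ℕP.*-identityʳ w))))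
                                         (ℕP.^-monoʳ-≤ 2 (ℕP.≤-reflexive (ℕP.*-identityˡ d)))) ∑Dw2^d≤ρ

    exponent : ℕ → ℕ → ℕ
    exponent j e = suc j ℕ.+ e

    Y : ℕ
    Y = J ℕ.+ Λ

    powerWeight : ℕ → ℤ
    powerWeight = spread d J P (λ i j → + δ i j) exponent

    -- v x is the coefficient of m_{x+1}(k).
    v : ℕ → ℤ
    v x = ∑ Y (λ y → powerWeight y * kronecker (2 ℕ.^ y) (suc x))

    ∣v∣≤ℓ : ∀ x → ∣ v x ∣ ℕ.≤ ℓ
    ∣v∣≤ℓ x = ℕP.≤-trans (∣∑-kronecker∣≤ Y powerWeight (2 ℕ.^_) (suc x) (λ _ _ → 2^-injective) (λ y _ → ∣powerWeight∣≤))
                         (ℕP.≤-trans (ℕP.≤-reflexive (ℕP.*-comm B ρ)) (ℕP.≤-trans (ℕP.m≤m+n (ρ ℕ.* B) ρ) ℓ₀≤ℓ))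
      where
      ∣powerWeight∣≤ : ∀ {y} → ∣ powerWeight y ∣ ℕ.≤ B ℕ.* ρ
      ∣powerWeight∣≤ {y} = ∣spread∣≤ d J P (λ i j → + δ i j) exponent y (λ e i j eq → ℕP.suc-injective (ℕP.+-cancelʳ-≡ e (suc i) (suc j) eq)) δ≤ρ

    4^Y≤4k4^Λ : 4^ Y ℕ.≤ 4 ℕ.* k ℕ.* 4^ Λ
    4^Y≤4k4^Λ = ℕP.≤-trans (ℕP.≤-reflexive (4^-+ J Λ)) (ℕP.*-monoˡ-≤ (4^ Λ) 4^J≤4k)

    2^Y≤n : 2 ℕ.^ Y ℕ.≤ n
    2^Y≤n = k₀-maximal {p = p} {k = k} isK0 (K0Cond-near p k (2 ℕ.^ Y) 0<lead (ℕP.≤-trans (s≤s z≤n) 2≤d) 2w≤k near)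
      where
      open ℕP.≤-Reasoning
      reorder₁ : ∀ a t → (a ℕ.* t) ℕ.* (a ℕ.* t) ≡ (a ℕ.* a) ℕ.* (t ℕ.* t)
      reorder₁ = ℕSolver.solve-∀
      reorder₂ : ∀ a k c → a ℕ.* (4 ℕ.* k ℕ.* c) ≡ (a ℕ.* (4 ℕ.* c)) ℕ.* k
      reorder₂ = ℕSolver.solve-∀
      M2^Y≤k : M ℕ.* 2 ℕ.^ Y ℕ.≤ k
      M2^Y≤k = square-cancel-≤ _ _ (begin
        (M ℕ.* 2 ℕ.^ Y) ℕ.* (M ℕ.* 2 ℕ.^ Y)      ≡⟨ reorder₁ M (2 ℕ.^ Y) ⟩
        M ℕ.* M ℕ.* (2 ℕ.^ Y ℕ.* 2 ℕ.^ Y)        ≡⟨ cong (M ℕ.* M ℕ.*_) (4^≡2^*2^ Y) ⟨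
        M ℕ.* M ℕ.* 4^ Y                          ≤⟨ ℕP.*-monoʳ-≤ (M ℕ.* M) 4^Y≤4k4^Λ ⟩
        M ℕ.* M ℕ.* (4 ℕ.* k ℕ.* 4^ Λ)            ≡⟨ reorder₂ (M ℕ.* M) k (4^ Λ) ⟩
        M ℕ.* M ℕ.* (4 ℕ.* 4^ Λ) ℕ.* k            ≡⟨ cong (λ t → M ℕ.* M ℕ.* t ℕ.* k) (4^-suc Λ) ⟨
        M ℕ.* M ℕ.* 4^ (suc Λ) ℕ.* k              ≤⟨ ℕP.*-monoˡ-≤ k M²4^Λ+1≤k ⟩
        k ℕ.* k                                   ∎)
      2^Y+4≤5*2^Y : 2 ℕ.^ Y ℕ.+ 4 ℕ.≤ 5 ℕ.* 2 ℕ.^ Y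
      2^Y+4≤5*2^Y = ℕP.+-monoʳ-≤ (2 ℕ.^ Y) (ℕP.≤-trans (ℕP.≤-reflexive (sym (ℕP.*-identityʳ 4))) (ℕP.*-monoʳ-≤ 4 (1≤2^ Y)))
      near : suc (2 ℕ.* d ℕ.* w) ℕ.* (2 ℕ.^ Y ℕ.+ 4) ℕ.≤ k
      near = ℕP.≤-trans (ℕP.*-monoʳ-≤ (suc (2 ℕ.* d ℕ.* w)) 2^Y+4≤5*2^Y)
                        (ℕP.≤-trans (ℕP.≤-reflexive (reorder₃ (suc (2 ℕ.* d ℕ.* w)) (2 ℕ.^ Y))) M2^Y≤k)
        where
        reorder₃ : ∀ a t → a ℕ.* (5 ℕ.* t) ≡ 5 ℕ.* a ℕ.* t
        reorder₃ = ℕSolver.solve-∀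

    mₖ : ℕ → ℤ
    mₖ x = m p (+ x) (+ k)

    block≡scale : ∀ i j → i ℕ.< d → ⟪ P i , (λ e → mₖ (2 ℕ.^ exponent j e)) ⟫ ≡ + scale i j
    block≡scale i j i<d = begin
      block p k (level i) (suc j)                                             ≡⟨ block-value p k (level i) (suc j) (ℕP.m<n⇒0<n∸m i<d) (level≤d i) ⟩
      c i * (2^ℤ (suc j ℕ.* level i) * + D i)                                 ≡⟨ cong₂ _*_ (c≡+∣c∣ i) (sym (ℤP.pos-* (2 ℕ.^ (suc j ℕ.* level i)) (D i))) ⟩
      + ∣ c i ∣ * + (2 ℕ.^ (suc j ℕ.* level i) ℕ.* D i)                       ≡⟨ ℤP.pos-* ∣ c i ∣ _ ⟨
      + (∣ c i ∣ ℕ.* (2 ℕ.^ (suc j ℕ.* level i) ℕ.* D i))                     ≡⟨ cong +_ (reorder ∣ c i ∣ (2 ℕ.^ (suc j ℕ.* level i)) (D i)) ⟩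
      + scale i j                                                             ∎
      where
      open ≡-Reasoning
      reorder : ∀ x t y → x ℕ.* (t ℕ.* y) ≡ y ℕ.* x ℕ.* t
      reorder = ℕSolver.solve-∀

    exponent<Y : ∀ i j e → i ℕ.< d → j ℕ.< J → e ℕ.< length (P i) → exponent j e ℕ.< Y
    exponent<Y i j e i<d j<J e<len = ℕP.+-mono-≤-< j<J (ℕP.<-≤-trans e<len (term≤∑ℕ d (λ i → length (P i)) i i<d))

    ∑v·m≡X : Σℤ n (λ i → v (toℕ i) * m p (+ suc (toℕ i)) (+ k)) ≡ + X
    ∑v·m≡X = begin
      Σℤ n (λ i → v (toℕ i) * m p (+ suc (toℕ i)) (+ k))
        ≡⟨ Σℤ≡∑ n (λ i → v (toℕ i) * m p (+ suc (toℕ i)) (+ k)) (λ x → v x * mₖ (suc x)) (λ _ → refl) ⟩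
      ∑ n (λ x → v x * mₖ (suc x))
        ≡⟨ ∑-cong n (λ x _ → distribute x) ⟩
      ∑ n (λ x → ∑ Y (λ y → powerWeight y * (kronecker (2 ℕ.^ y) (suc x) * mₖ (suc x))))
        ≡⟨ ∑-comm n Y (λ x y → powerWeight y * (kronecker (2 ℕ.^ y) (suc x) * mₖ (suc x))) ⟩
      ∑ Y (λ y → ∑ n (λ x → powerWeight y * (kronecker (2 ℕ.^ y) (suc x) * mₖ (suc x))))
        ≡⟨ ∑-cong Y (λ y y<Y → select y y<Y) ⟩
      ∑ Y (λ y → powerWeight y * mₖ (2 ℕ.^ y))
        ≡⟨ ∑-spread d J Y P (λ i j → + δ i j) exponent (λ y → mₖ (2 ℕ.^ y)) exponent<Y ⟩
      ∑ d (λ i → ∑ J (λ j → + δ i j * ⟪ P i , (λ e → mₖ (2 ℕ.^ exponent j e)) ⟫))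
        ≡⟨ ∑-cong d (λ i i<d → ∑-cong J (λ j _ → trans (cong (+ δ i j *_) (block≡scale i j i<d)) (sym (ℤP.pos-* (δ i j) (scale i j))))) ⟩
      ∑ d (λ i → ∑ J (λ j → + (δ i j ℕ.* scale i j)))
        ≡⟨ ∑-cong d (λ i _ → ∑-pos J (λ j → δ i j ℕ.* scale i j)) ⟩
      ∑ d (λ i → + ∑ℕ J (λ j → δ i j ℕ.* scale i j))
        ≡⟨ ∑-pos d (λ i → ∑ℕ J (λ j → δ i j ℕ.* scale i j)) ⟩
      + X ∎
      where
      open ≡-Reasoning
      distribute : ∀ x → v x * mₖ (suc x) ≡ ∑ Y (λ y → powerWeight y * (kronecker (2 ℕ.^ y) (suc x) * mₖ (suc x)))
      distribute x = trans (sym (∑-*ʳ Y (mₖ (suc x)) (λ y → powerWeight y * kronecker (2 ℕ.^ y) (suc x))))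
                           (∑-cong Y (λ y _ → ℤP.*-assoc (powerWeight y) (kronecker (2 ℕ.^ y) (suc x)) (mₖ (suc x))))
      select : ∀ y → y ℕ.< Y → ∑ n (λ x → powerWeight y * (kronecker (2 ℕ.^ y) (suc x) * mₖ (suc x))) ≡ powerWeight y * mₖ (2 ℕ.^ y)
      select y y<Y = trans (∑-*ˡ n (powerWeight y) (λ x → kronecker (2 ℕ.^ y) (suc x) * mₖ (suc x)))
                           (cong (powerWeight y *_) (∑-kronecker-suc n (2 ℕ.^ y) mₖ (1≤2^ y) (ℕP.≤-trans (ℕP.^-monoʳ-≤ 2 (ℕP.<⇒≤ y<Y)) 2^Y≤n)))

    powerWeight₀≡0 : powerWeight 0 ≡ 0ℤ
    powerWeight₀≡0 = ∑-zero d (λ i _ → ⟪⟫-zero (P i) (λ e → ∑-zero J (λ j _ → no-hit i j e)))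
      where
      no-hit : ∀ i j e → + δ i j * kronecker (exponent j e) 0 ≡ 0ℤ
      no-hit i j e = trans (cong (+ δ i j *_) (kronecker-≢ (λ ()))) (ℤP.*-zeroʳ (+ δ i j))

    -- Only t = 1 is needed: every index carrying weight is a power of two.
    support : ∀ x → v x ≢ + 0 → ∃[ t ] ∃[ j ] ((1 ℕ.≤ t) × (t ℕ.≤ d ℕ.∸ 1) × (1 ℕ.≤ j)
              × (2 ℕ.^ (2 ℕ.* j) ℕ.≤ 2 ℕ.^ (2 ℕ.* q) ℕ.* k) × (suc x ≡ t ℕ.* 2 ℕ.^ j))
    support x v≢0 = from-power (∑≢0⇒∃term≢0 Y (λ y → powerWeight y * kronecker (2 ℕ.^ y) (suc x)) v≢0)
      where
      from-power : ∃[ y ] (y ℕ.< Y × powerWeight y * kronecker (2 ℕ.^ y) (suc x) ≢ 0ℤ) →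
        ∃[ t ] ∃[ j ] ((1 ℕ.≤ t) × (t ℕ.≤ d ℕ.∸ 1) × (1 ℕ.≤ j)
          × (2 ℕ.^ (2 ℕ.* j) ℕ.≤ 2 ℕ.^ (2 ℕ.* q) ℕ.* k) × (suc x ≡ t ℕ.* 2 ℕ.^ j))
      from-power (zero  , _   , term≢0) = ⊥-elim (term≢0 (trans (cong (_* kronecker 1 (suc x)) powerWeight₀≡0) (ℤP.*-zeroˡ (kronecker 1 (suc x)))))
      from-power (suc y , y<Y , term≢0) =
        1 , suc y , ℕP.≤-refl , ℕP.m+n≤o⇒m≤o∸n 1 2≤d , s≤s z≤n , 4^y≤4^q*k ,
        trans (sym (kronecker≢0⇒≡ (2 ℕ.^ suc y) (suc x) δ≢0)) (sym (ℕP.*-identityˡ (2 ℕ.^ suc y)))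
        where
        δ≢0 : kronecker (2 ℕ.^ suc y) (suc x) ≢ 0ℤ
        δ≢0 δ≡0 = term≢0 (trans (cong (powerWeight (suc y) *_) δ≡0) (ℤP.*-zeroʳ (powerWeight (suc y))))
        4^y≤4^q*k : 4^ (suc y) ℕ.≤ 4^ q ℕ.* k
        4^y≤4^q*k = ℕP.*-cancelˡ-≤ 4 (begin
          4 ℕ.* 4^ (suc y)       ≡⟨ 4^-suc (suc y) ⟨
          4^ (suc (suc y))       ≤⟨ 4^-mono-≤ y<Y ⟩
          4^ Y                   ≤⟨ 4^Y≤4k4^Λ ⟩
          4 ℕ.* k ℕ.* 4^ Λ       ≤⟨ ℕP.*-monoʳ-≤ (4 ℕ.* k) (4^-mono-≤ q₀≤q) ⟩
          4 ℕ.* k ℕ.* 4^ q       ≡⟨ reorder k (4^ q) ⟩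
          4 ℕ.* (4^ q ℕ.* k)     ∎)
          where
          open ℕP.≤-Reasoning
          reorder : ∀ k t → 4 ℕ.* k ℕ.* t ≡ 4 ℕ.* (t ℕ.* k)
          reorder = ℕSolver.solve-∀

lemma2p2 : (p : Poly) → 2 ℕ.≤ deg p → + 0 ℤ.< leading p → NonOdd p →
    ∃[ q₀ ] ((q : ℕ) → 1 ℕ.≤ q → q₀ ℕ.≤ q →
    ∃[ ℓ₀ ] ((ℓ : ℕ) → 1 ℕ.≤ ℓ → ℓ₀ ℕ.≤ ℓ →
    ∃[ K ] ((k : ℕ) → 1 ℕ.≤ k → K ℕ.≤ k →
    (n : ℕ) → IsK0 p (+ k) (+ k ℤ.+ + n) →
    (Q′ : ℕ) → 1 ℕ.≤ Q′ → Q′ ℕ.≤ q ℕ.* k ℕ.^ (deg p ℕ.∸ 1) →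
    Σ[ v ∈ (Fin n → ℤ) ]
      (((i : Fin n) → ∣ v i ∣ ℕ.≤ ℓ)
      × (+ Q′ ℤ.- + ℓ ℤ.≤ Σℤ n (λ i → v i ℤ.* m p (+ suc (toℕ i)) (+ k)))
      × (Σℤ n (λ i → v i ℤ.* m p (+ suc (toℕ i)) (+ k)) ℤ.≤ + Q′ ℤ.+ + ℓ)
      × ((i : Fin n) → v i ≢ + 0 →
          ∃[ t ] ∃[ j ] ((1 ℕ.≤ t) × (t ℕ.≤ deg p ℕ.∸ 1) × (1 ℕ.≤ j)
            × (2 ℕ.^ (2 ℕ.* j) ℕ.≤ 2 ℕ.^ (2 ℕ.* q) ℕ.* k)
            × (suc (toℕ i) ≡ t ℕ.* 2 ℕ.^ j)))))))
lemma2p2 p 2≤d 0<lead _ =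
  q₀ , λ q _ q₀≤q → ℓ₀ , λ ℓ _ ℓ₀≤ℓ → K q , λ k _ K≤k n isK0 Q _ Q≤ →
    let open Instance q q₀≤q ℓ ℓ₀≤ℓ k K≤k n isK0 Q Q≤
        lower , upper = within-± Q≡X+r r≤ℓ
    in (λ i → v (toℕ i)) , (λ i → ∣v∣≤ℓ (toℕ i)) ,
       ℤP.≤-trans lower (ℤP.≤-reflexive (sym ∑v·m≡X)) , ℤP.≤-trans (ℤP.≤-reflexive ∑v·m≡X) upper ,
       (λ i → support (toℕ i))
  where open Construction p 2≤d 0<lead
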